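{- Let $\mathcal F$ be a family of automata networks. (1) If $\mathcal F$ is universal then, for any polynomial map $\rho$, there is a polynomial distortion $\delta$ such that every $\rho$-succinct orbit graph can be embedded into (the orbit graph of) some $F\in\mathcal F$ with distortion $\delta$. In particular $\mathcal F$ contains networks with super-polynomial periods and transients, and with a super-polynomial number of disjoint periodic orbits of period at most polynomial. (2) If $\mathcal F$ is strongly universal then it embeds the orbit graph of any bounded-degree automata network with linear distortion (i.e. for every finite $Q$ and $\Delta\ge1$ there is a linear $\delta$ such that the orbit graph of every member of $\mathcal B_{Q,\Delta}$ embeds into some member of $\mathcal F$ with distortion $\delta$). In particular $\mathcal F$ contains networks with exponential periods and transients, and with an exponential number of disjoint periodic orbits of period at most linear.
   Context: An automata network is $F:Q^V\to Q^V$ with $Q,V$ finite. Its orbit graph $G_F$ is the directed graph on $Q^V$ with an edge $x\to F(x)$ for each $x$; $G_F^t$ denotes $G_{F^t}$. Periods and transients are those of orbits $(F^t(x))_t$ (least $\tau,p\ge1$ with $F^{\tau+p}(x)=F^\tau(x)$). For $\rho:\mathbb N\to\mathbb N$, the orbit graph of $F$ with $n$ nodes is $\rho$-succinct if $F$ has a circuit encoding of size at most $\rho(n)$. For $\delta:\mathbb N\to\mathbb N$, the orbit graph of $H$ with $m$ nodes embeds $G_F$ ($F$ with $n$ nodes) with distortion $\delta$ if $m\le\delta(n)$ and there is $T\le\delta(n)$ such that $G_F$ is (isomorphic to) a subgraph of $G_{H^T}$. Representations and simulation. A communication graph of $F$ is a directed graph on $V$ such that $F(x)_v$ depends only on in-neighbours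 of $v$. For each finite alphabet fix an injective $m_Q:Q\to\{0,1\}^{k_Q}$ extended cellwise; a circuit encoding of $F:Q^n\to Q^n$ is a Boolean circuit $C$ with $m_Q\circ F=C\circ m_Q$. Families are taken with a standard representation: a language with a logarithmic-space algorithm producing a circuit encoding of a member from each word, all members represented. A block embedding of $Q_F^{V_F}$ into $Q_G^{V_G}$ is a partition $(D_i)_{i\in V_F}$ of $V_G$ with patterns $p_{i,q}\in Q_G^{D_i}$ injective in $q$, giving $\phi(x)|_{D_i}=p_{i,x_i}$; $G$ simulates $F$ via $\phi$ with time constant $T$ if $\phi\circ F=G^T\circ\phi$. A family $(\mathcal F,\mathcal F^*)$ simulates $(\mathcal H,\mathcal H^*)$ in time $T$ and space $S$ if a logarithmic-space Turing machine maps each word representing $H:Q_H^n\to Q_H^n$ to a word representing $F\in\mathcal F$ on $S(n)$ nodes, the number $T(n)$ and a block embedding via which $F$ simulates $H$ with time constant $T(n)$. $\mathcal U_{Q,P}$ ($P$ polynomial) is the family of all $F:Q^n\to Q^n$ with a circuit encoding of size $\le P(n)$, represented by such circuits; a family is universal if for every finite $Q$ and polynomial $P$ it simulates $\mathcal U_{Q,P}$ in polynomial time $T$ and polynomial space $S$. $\mathcal B_{Q,\Delta}$ is the family of networks over $Q$ with a communication graph of maximum degree $\le\Delta$, represented by such a graph plus local transition tables; a family is strongly universal if for all finite $Q$ and all $\Delta\ge1$ it simulates $\mathcal B_{Q,\Delta}$ in constant time $T$ and linear space $S$. -}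

module Defs where

open import Data.Nat using (ℕ; zero; suc; _+_; _*_; _^_; _≤_; _<_; _/_)
open import Data.Nat.Logarithm using (⌊log₂_⌋)
open import Data.Nat.Binary.Base using (ℕᵇ; 2[1+_]; 1+[2_]) renaming (zero to zeroᵇ; fromℕ to toBin)
open import Data.Bool using (Bool; true; false; if_then_else_; _∧_; _∨_; not)
open import Data.Fin as Fin using (Fin; toℕ; remQuot)
open import Data.Fin using (zero; suc)
open import Data.List using (List; []; _∷_; _++_; length; map; allFin; filter)
open import Data.List.Membership.Propositional using (_∈_)
open import Data.List.Relation.Unary.Any using (any?)
open import Data.List.Relation.Unary.Unique.Propositional using (Unique)
open import Data.List.Relation.Unary.All using (All)
open import Data.Maybe using (Maybe; just; nothing; _>>=_)
open import Data.Vec using (Vec; lookup; tabulate; fromList)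
import Data.Vec as Vec
open import Data.Product using (Σ; ∃; _×_; _,_; proj₁; proj₂)
open import Relation.Binary.PropositionalEquality using (_≡_; _≢_)
open import Relation.Nullary using (¬_)

-- polynomials with natural coefficients (lowest degree first)
Poly : Set
Poly = List ℕ

evalPoly : Poly → ℕ → ℕ
evalPoly []       n = 0
evalPoly (a ∷ as) n = a + n * evalPoly as n

PolyBounded : (ℕ → ℕ) → Set
PolyBounded f = Σ Poly λ p → ∀ n → f n ≤ evalPoly p n

LinearBounded : (ℕ → ℕ) → Set
LinearBounded f = Σ ℕ λ a → Σ ℕ λ b → ∀ n → f n ≤ a * n + b

ConstBounded : (ℕ → ℕ) → Set
ConstBounded f = Σ ℕ λ c → ∀ n → f n ≤ c

Config : ℕ → ℕ → Set
Config q n = Vec (Fin q) n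

Net : ℕ → ℕ → Set
Net q n = Config q n → Config q n

iter : {A : Set} → (A → A) → ℕ → A → A
iter f zero    x = x
iter f (suc t) x = f (iter f t x)

IsPeriod : ∀ {q n} → Net q n → Config q n → ℕ → Set
IsPeriod F x p =
  (1 ≤ p) × (Σ ℕ λ τ → (1 ≤ τ) × (iter F (τ + p) x ≡ iter F τ x)) ×
  (∀ p' τ → 1 ≤ p' → 1 ≤ τ → iter F (τ + p') x ≡ iter F τ x → p ≤ p')

IsTransient : ∀ {q n} → Net q n → Config q n → ℕ → Set
IsTransient F x τ =
  (1 ≤ τ) × (Σ ℕ λ p → (1 ≤ p) × (iter F (τ + p) x ≡ iter F τ x)) ×
  (∀ τ' p → 1 ≤ τ' → 1 ≤ p → iter F (τ' + p) x ≡ iter F τ' x → τ ≤ τ')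

PeriodicLe : ∀ {q n} → Net q n → ℕ → Config q n → Set
PeriodicLe F b x = Σ ℕ λ k → (1 ≤ k) × (k ≤ b) × (iter F k x ≡ x)

DisjointOrbits : ∀ {q n} → Net q n → Config q n → Config q n → Set
DisjointOrbits F x y = ∀ i j → iter F i x ≢ iter F j y

PairwiseDisjoint : ∀ {q n} → Net q n → List (Config q n) → Set
PairwiseDisjoint F []       = ⊤'
  where open import Data.Unit using () renaming (⊤ to ⊤')
PairwiseDisjoint F (x ∷ xs) = All (DisjointOrbits F x) xs × PairwiseDisjoint F xs

-- orbit graph of F (q,n) embeds into orbit graph of H (q',m) with distortion δ:
-- m ≤ δ n and for some T ≤ δ n, G_F is isomorphic to a subgraph of G_{H^T}
-- (an injective vertex map sending each edge x → F x to an edge of G_{H^T}).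
EmbedsWith : (ℕ → ℕ) → ∀ {q n q' m} → Net q n → Net q' m → Set
EmbedsWith δ {q} {n} {q'} {m} F H =
  (m ≤ δ n) × Σ ℕ λ T → (T ≤ δ n) ×
    Σ (Config q n → Config q' m) λ φ →
      (∀ x y → φ x ≡ φ y → x ≡ y) × (∀ x → iter H T (φ x) ≡ φ (F x))

data Gate (m : ℕ) : Set where
  AND OR : Fin m → Fin m → Gate m
  NOT    : Fin m → Gate m

-- Gates k m : a circuit body with k inputs and m wires in total;
-- wire zero is the most recently added gate (de Bruijn style).
data Gates (k : ℕ) : ℕ → Set where
  []  : Gates k k
  _▷_ : ∀ {m} → Gates k m → Gate m → Gates k (suc m)

evalGate : ∀ {m} → Gate m → (Fin m → Bool) → Bool
evalGate (AND i j) w = w i ∧ w j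
evalGate (OR i j)  w = w i ∨ w j
evalGate (NOT i)   w = not (w i)

wires : ∀ {k m} → Gates k m → (Fin k → Bool) → Fin m → Bool
wires []       ρ i       = ρ i
wires (gs ▷ g) ρ zero    = evalGate g (wires gs ρ)
wires (gs ▷ g) ρ (suc i) = wires gs ρ i

gateCount : ∀ {k m} → Gates k m → ℕ
gateCount []       = 0
gateCount (gs ▷ g) = suc (gateCount gs)

record Circuit (k o : ℕ) : Set where
  field
    m     : ℕ
    gates : Gates k m
    out   : Fin o → Fin m

evalC : ∀ {k o} → Circuit k o → (Fin k → Bool) → Fin o → Bool
evalC C ρ i = wires (Circuit.gates C) ρ (Circuit.out C i)

size : ∀ {k o} → Circuit k o → ℕ
size C = gateCount (Circuit.gates C)

-- fixed injective encoding m_Q : Fin q → {0,1}^q (one-hot), extended cellwise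
oneHot : ∀ {q n} → Config q n → Fin (n * q) → Bool
oneHot {q} x i with remQuot q i
... | v , a = Fin.toℕ (lookup x v) Data.Nat.≡ᵇ Fin.toℕ a
  where import Data.Nat

IsCircuitFor : ∀ {q n} → Net q n → Circuit (n * q) (n * q) → Set
IsCircuitFor F C = ∀ x i → evalC C (oneHot x) i ≡ oneHot (F x) i

Succinct : (ℕ → ℕ) → ∀ {q n} → Net q n → Set
Succinct ρ {q} {n} F = Σ (Circuit (n * q) (n * q)) λ C → IsCircuitFor F C × (size C ≤ ρ n)

Word : Set
Word = List Bool

data Tree : Set where
  bit  : Bool → Tree
  node : List Tree → Tree

mutual
  enc : Tree → Word
  enc (bit b)   = false ∷ b ∷ []
  enc (node ts) = true ∷ false ∷ (encs ts ++ (true ∷ true ∷ []))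

  encs : List Tree → Word
  encs []       = []
  encs (t ∷ ts) = enc t ++ encs ts

digitsᵇ : ℕᵇ → List Bool
digitsᵇ zeroᵇ    = []
digitsᵇ 2[1+ x ] = true ∷ digitsᵇ x
digitsᵇ 1+[2 x ] = false ∷ digitsᵇ x

tℕ : ℕ → Tree
tℕ n = node (map bit (digitsᵇ (toBin n)))

tFin : ∀ {n} → Fin n → Tree
tFin i = tℕ (toℕ i)

tWord : Word → Tree
tWord w = node (map bit w)

tGate : ∀ {m} → Gate m → Tree
tGate (AND i j) = node (tℕ 0 ∷ tFin i ∷ tFin j ∷ [])
tGate (OR i j)  = node (tℕ 1 ∷ tFin i ∷ tFin j ∷ [])
tGate (NOT i)   = node (tℕ 2 ∷ tFin i ∷ [])

tGates : ∀ {k m} → Gates k m → List Tree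
tGates []       = []
tGates (gs ▷ g) = tGate g ∷ tGates gs

tCirc : ∀ {k o} → Circuit k o → Tree
tCirc {k} {o} C =
  node (tℕ k ∷ tℕ (Circuit.m C) ∷ node (tGates (Circuit.gates C))
        ∷ node (map (λ i → tFin (Circuit.out C i)) (allFin o)) ∷ [])

tNet : (q n : ℕ) → Circuit (n * q) (n * q) → Tree
tNet q n C = node (tℕ q ∷ tℕ n ∷ tCirc C ∷ [])

-- Logarithmic-space Turing machines (read-only two-way input tape with
-- end markers, one work tape, write-only output tape)

data InSym : Set where
  lend rend : InSym
  sym       : Bool → InSym

data Move : Set where
  left right stay : Move

record TM : Set where
  field
    nQ    : ℕ
    start : Fin nQ
    nΓ    : ℕ                  -- work alphabet Fin (suc nΓ), zero = blank
    δ     : Fin nQ → InSym → Fin (suc nΓ) →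
            Maybe (Fin nQ × Fin (suc nΓ) × Move × Move × Maybe Bool)
            -- nothing = halt; otherwise new state, written work symbol,
            -- input-head move, work-head move, optional output bit

record TMConfig (M : TM) : Set where
  field
    state : Fin (TM.nQ M)
    ipos  : ℕ                      -- 0 = left marker, 1..|w| symbols, |w|+1 right marker
    tape  : ℕ → Fin (suc (TM.nΓ M))
    wpos  : ℕ
    out   : Word

readIn : Word → ℕ → InSym
readIn w       zero    = lend
readIn []      (suc i) = rend
readIn (b ∷ w) (suc zero) = sym b
readIn (b ∷ w) (suc (suc i)) = readIn w (suc i)

moveIn : Word → Move → ℕ → ℕ
moveIn w left  zero    = zero
moveIn w left  (suc i) = i
moveIn w right i       = Data.Nat._⊓_ (suc i) (suc (length w))
  where import Data.Nat
moveIn w stay  i       = i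

moveW : Move → ℕ → ℕ
moveW left  zero    = zero
moveW left  (suc i) = i
moveW right i       = suc i
moveW stay  i       = i

initConfig : (M : TM) → TMConfig M
initConfig M = record { state = TM.start M ; ipos = 0 ; tape = λ _ → zero ; wpos = 0 ; out = [] }

step : (M : TM) → Word → TMConfig M → Maybe (TMConfig M)
step M w c with TM.δ M (TMConfig.state c) (readIn w (TMConfig.ipos c)) (TMConfig.tape c (TMConfig.wpos c))
... | nothing = nothing
... | just (s , γ , mi , mw , o) = just (record
        { state = s
        ; ipos  = moveIn w mi (TMConfig.ipos c)
        ; tape  = λ j → if j Data.Nat.≡ᵇ TMConfig.wpos c then γ else TMConfig.tape c j
        ; wpos  = moveW mw (TMConfig.wpos c)
        ; out   = TMConfig.out c ++ outBit o })
  where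
    import Data.Nat
    outBit : Maybe Bool → Word
    outBit nothing  = []
    outBit (just b) = b ∷ []

exec : (M : TM) → Word → ℕ → TMConfig M → Maybe (TMConfig M)
exec M w zero    c = just c
exec M w (suc t) c = step M w c >>= exec M w t

LogspaceOn : (Word → Set) → (Word → Word) → Set
LogspaceOn D f = Σ TM λ M → Σ ℕ λ c → ∀ w → D w →
  Σ ℕ λ t → Σ (TMConfig M) λ cf →
    (exec M w t (initConfig M) ≡ just cf) × (step M w cf ≡ nothing) ×
    (TMConfig.out cf ≡ f w) ×
    (∀ t' c' → t' ≤ t → exec M w t' (initConfig M) ≡ just c' →
       TMConfig.wpos c' ≤ c * ⌊log₂ (length w) ⌋ + c)

record Family : Set₁ where
  field
    L        : Word → Set
    gen      : Word → Word
    gen-ls   : LogspaceOn L gen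
    gen-ok   : ∀ w → L w → Σ ℕ λ q → Σ ℕ λ n → Σ (Circuit (n * q) (n * q)) λ C →
                 (gen w ≡ enc (tNet q n C)) × Σ (Net q n) λ F → IsCircuitFor F C

Representation : Set₁
Representation = Word → (q n : ℕ) → Net q n → Set

RepF : Family → Representation
RepF 𝓕 w q n F = Family.L 𝓕 w × Σ (Circuit (n * q) (n * q)) λ C →
  (Family.gen 𝓕 w ≡ enc (tNet q n C)) × IsCircuitFor F C

Member : Family → ∀ q n → Net q n → Set
Member 𝓕 q n F = Σ Word λ w → RepF 𝓕 w q n F

record BlockEmb (qH nH qF nF : ℕ) : Set where
  field
    blk  : Fin nF → Fin nH                 -- v ∈ D_(blk v)
    pat  : Fin qH → Fin nF → Fin qF        -- p_{blk v, a}(v) = pat a v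
    nonempty : ∀ i → Σ (Fin nF) λ v → blk v ≡ i
    inj  : ∀ i a b → (∀ v → blk v ≡ i → pat a v ≡ pat b v) → a ≡ b

embMap : ∀ {qH nH qF nF} → BlockEmb qH nH qF nF → Config qH nH → Config qF nF
embMap e x = tabulate (λ v → BlockEmb.pat e (lookup x (BlockEmb.blk e v)) v)

tEmb : ∀ {qH nH qF nF} → BlockEmb qH nH qF nF → Tree
tEmb {qH} {nH} {qF} {nF} e =
  node (node (map (λ v → tFin (BlockEmb.blk e v)) (allFin nF))
       ∷ node (map (λ a → node (map (λ v → tFin (BlockEmb.pat e a v)) (allFin nF))) (allFin qH))
       ∷ [])

SimulatesVia : ∀ {qH nH qF nF} → Net qF nF → Net qH nH → BlockEmb qH nH qF nF → ℕ → Set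
SimulatesVia F H e T = ∀ x → embMap e (H x) ≡ iter F T (embMap e x)

Simulates : Family → Representation → (ℕ → ℕ) → (ℕ → ℕ) → Set
Simulates 𝓕 R T S =
  Σ (Word → Word) λ f →
    LogspaceOn (λ w → Σ ℕ λ q → Σ ℕ λ n → Σ (Net q n) λ H → R w q n H) f ×
    (∀ w q n H → R w q n H →
       Σ Word λ w' → Σ ℕ λ qF → Σ (Net qF (S n)) λ F → Σ (BlockEmb q n qF (S n)) λ e →
         (f w ≡ enc (node (tWord w' ∷ tℕ (T n) ∷ tEmb e ∷ []))) ×
         RepF 𝓕 w' qF (S n) F × SimulatesVia F H e (T n))

RepU : ℕ → Poly → Representation
RepU q P w q' n H = (q' ≡ q) × Σ (Circuit (n * q') (n * q')) λ C →
  (w ≡ enc (tNet q' n C)) × (size C ≤ evalPoly P n) × IsCircuitFor H C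

Universal : Family → Set
Universal 𝓕 = ∀ q (P : Poly) → Σ (ℕ → ℕ) λ T → Σ (ℕ → ℕ) λ S →
  PolyBounded T × PolyBounded S × Simulates 𝓕 (RepU q P) T S

-- a directed graph on Fin n given by in-neighbour lists (u → v iff u ∈ nb v)
InNbrs : ℕ → Set
InNbrs n = Fin n → List (Fin n)

outDeg : ∀ {n} → InNbrs n → Fin n → ℕ
outDeg {n} nb u = length (filter (λ v → any? (Fin._≟ u) (nb v)) (allFin n))

MaxDeg : ℕ → ∀ {n} → InNbrs n → Set
MaxDeg Δ nb = (∀ v → Unique (nb v) × (length (nb v) ≤ Δ)) × (∀ u → outDeg nb u ≤ Δ)

IsCommGraph : ∀ {q n} → Net q n → InNbrs n → Set
IsCommGraph F nb = ∀ x y v → (∀ u → u ∈ nb v → lookup x u ≡ lookup y u) →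
  lookup (F x) v ≡ lookup (F y) v

InB : (q Δ n : ℕ) → Net q n → Set
InB q Δ n F = Σ (InNbrs n) λ nb → MaxDeg Δ nb × IsCommGraph F nb

data Table (q : ℕ) : ℕ → Set where
  tab0 : Fin q → Table q 0
  tabS : ∀ {d} → (Fin q → Table q d) → Table q (suc d)

applyT : ∀ {q d} → Table q d → Vec (Fin q) d → Fin q
applyT (tab0 a) Vec.[]       = a
applyT (tabS f) (a Vec.∷ as) = applyT (f a) as

tTable : ∀ {q d} → Table q d → Tree
tTable (tab0 a)         = tFin a
tTable {q} (tabS f) = node (map (λ a → tTable (f a)) (allFin q))

record BDesc (q n : ℕ) : Set where
  field
    nb  : InNbrs n
    tbl : (v : Fin n) → Table q (length (nb v))

netOf : ∀ {q n} → BDesc q n → Net q n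
netOf D x = tabulate (λ v → applyT (BDesc.tbl D v) (Vec.map (lookup x) (fromList (BDesc.nb D v))))

tB : ∀ {q n} → BDesc q n → Tree
tB {q} {n} D = node (tℕ q ∷ tℕ n ∷
  node (map (λ v → node (node (map tFin (BDesc.nb D v)) ∷ tTable (BDesc.tbl D v) ∷ [])) (allFin n)) ∷ [])

RepB : ℕ → ℕ → Representation
RepB q Δ w q' n H = (q' ≡ q) × Σ (BDesc q' n) λ D →
  MaxDeg Δ (BDesc.nb D) × (w ≡ enc (tB D)) × (∀ x → H x ≡ netOf D x)

StronglyUniversal : Family → Set
StronglyUniversal 𝓕 = ∀ q Δ → 1 ≤ Δ → Σ (ℕ → ℕ) λ T → Σ (ℕ → ℕ) λ S →
  ConstBounded T × LinearBounded S × Simulates 𝓕 (RepB q Δ) T S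

PolyEmbedding : Family → Set
PolyEmbedding 𝓕 = ∀ q (ρ : Poly) → Σ Poly λ δ →
  ∀ n (F : Net q n) → Succinct (evalPoly ρ) F →
    Σ ℕ λ q' → Σ ℕ λ m → Σ (Net q' m) λ H → Member 𝓕 q' m H × EmbedsWith (evalPoly δ) F H

SuperPolyPeriods : Family → Set
SuperPolyPeriods 𝓕 = ∀ (p : Poly) N → Σ ℕ λ q → Σ ℕ λ n → Σ (Net q n) λ F →
  (N ≤ n) × Member 𝓕 q n F × Σ (Config q n) λ x → Σ ℕ λ per → IsPeriod F x per × (evalPoly p n < per)

SuperPolyTransients : Family → Set
SuperPolyTransients 𝓕 = ∀ (p : Poly) N → Σ ℕ λ q → Σ ℕ λ n → Σ (Net q n) λ F →
  (N ≤ n) × Member 𝓕 q n F × Σ (Config q n) λ x → Σ ℕ λ τ → IsTransient F x τ × (evalPoly p n < τ)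

SuperPolyManyOrbits : Family → Set
SuperPolyManyOrbits 𝓕 = Σ Poly λ r → ∀ (p : Poly) N → Σ ℕ λ q → Σ ℕ λ n → Σ (Net q n) λ F →
  (N ≤ n) × Member 𝓕 q n F × Σ (List (Config q n)) λ xs →
    (evalPoly p n < length xs) × All (PeriodicLe F (evalPoly r n)) xs × PairwiseDisjoint F xs

LinearEmbedding : Family → Set
LinearEmbedding 𝓕 = ∀ q Δ → 1 ≤ Δ → Σ ℕ λ a → Σ ℕ λ b →
  ∀ n (F : Net q n) → InB q Δ n F →
    Σ ℕ λ q' → Σ ℕ λ m → Σ (Net q' m) λ H → Member 𝓕 q' m H × EmbedsWith (λ k → a * k + b) F H

ExpPeriods : Family → Set
ExpPeriods 𝓕 = Σ ℕ λ c → ∀ N → Σ ℕ λ q → Σ ℕ λ n → Σ (Net q n) λ F →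
  (N ≤ n) × Member 𝓕 q n F × Σ (Config q n) λ x → Σ ℕ λ per → IsPeriod F x per × (2 ^ (n / suc c) ≤ per)

ExpTransients : Family → Set
ExpTransients 𝓕 = Σ ℕ λ c → ∀ N → Σ ℕ λ q → Σ ℕ λ n → Σ (Net q n) λ F →
  (N ≤ n) × Member 𝓕 q n F × Σ (Config q n) λ x → Σ ℕ λ τ → IsTransient F x τ × (2 ^ (n / suc c) ≤ τ)

ExpManyOrbits : Family → Set
ExpManyOrbits 𝓕 = Σ ℕ λ c → Σ ℕ λ a → Σ ℕ λ b → ∀ N → Σ ℕ λ q → Σ ℕ λ n → Σ (Net q n) λ F →
  (N ≤ n) × Member 𝓕 q n F × Σ (List (Config q n)) λ xs →
    (2 ^ (n / suc c) ≤ length xs) × All (PeriodicLe F (a * n + b)) xs × PairwiseDisjoint F xs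

{-# OPTIONS --safe #-}
-- A simulation with time constant T is an injective map φ with H^T ∘ φ = φ ∘ F, so the H-orbit of
-- φ x passes through φ (F^t x) at time t T. Hence (once F moves some point, forcing T ≥ 1) periods
-- and transients of F are lower bounds for those of H, and if F is an involution every φ x returns
-- after 2 T steps, so choosing orbit representatives greedily gives at least q^n / 2T disjoint
-- periodic H-orbits. It remains to simulate two networks in which every node reads only itself and
-- its predecessor, so that they have degree 2 and circuits of linear size: a pipelined binary
-- counter on n + 1 cells, whose orbit from zero has period and transient at least 2^n, and a
-- network flipping one bit, an involution on 4^(n+1) configurations. Universality keeps the size
-- and time of the simulator polynomial, strong universality linear and constant, which turns these
-- bounds into super-polynomial, respectively exponential, ones.
module Submission where

open import Defs hiding (sym)
open import Data.Nat using (ℕ; zero; suc; _+_; _*_; _∸_; _^_; _≤_; _<_; _≤?_; z≤n; s≤s; NonZero; >-nonZero; >-nonZero⁻¹; pred; _%_; _/_; _≡ᵇ_)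
open import Data.Nat.Properties
open import Data.Nat.DivMod using (m≡m%n+[m/n]*n; m%n<n; m*n/n≡m; /-monoˡ-≤)
open import Data.Nat.Induction using (<-wellFounded)
open import Data.Nat.Solver using (module +-*-Solver)
open import Data.Bool using (Bool; true; false; if_then_else_; _∧_; _∨_; not; _xor_)
open import Data.Bool.Properties using (∨-identityʳ; ∨-zeroʳ; ∧-identityʳ; ∧-zeroʳ; ∧-inverseʳ; ∧-distribˡ-∨)
open import Data.Fin as Fin using (Fin; toℕ; combine; remQuot; fromℕ<; inject₁)
open import Data.Fin using (zero; suc)
open import Data.Fin.Properties using (pigeonhole; injective⇒≤; combine-injective; remQuot-combine; combine-remQuot; toℕ-fromℕ<; toℕ-injective; toℕ-inject₁)
open import Data.List using (List; []; _∷_; length; allFin)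
import Data.List as List
open import Data.List.Membership.Propositional using (_∈_)
open import Data.List.Relation.Unary.Any as Any using (Any; here; there; any?)
open import Data.List.Relation.Unary.Any.Properties using (lookup-index)
open import Data.List.Relation.Unary.All as All using (All; []; _∷_)
open import Data.List.Relation.Unary.All.Properties using (tabulate⁺; tabulate⁻; all-filter)
open import Data.List.Relation.Unary.AllPairs using ([]; _∷_)
open import Data.List.Relation.Unary.Unique.Propositional using (Unique)
open import Data.List.Relation.Unary.Unique.Propositional.Properties using (filter⁺; allFin⁺)
open import Data.Vec using (Vec; []; _∷_; lookup; tabulate; replicate; fromList)
import Data.Vec as Vec
open import Data.Vec.Properties using (≡-dec; tabulate∘lookup; tabulate-cong; lookup∘tabulate)
open import Data.Product using (Σ; ∃; ∃₂; _×_; _,_; proj₁; proj₂)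
open import Data.Sum using (_⊎_; inj₁; inj₂)
open import Data.Empty using (⊥; ⊥-elim)
open import Data.Unit using (tt)
open import Function using (_∘_)
open import Function.Definitions using (Injective)
open import Induction.WellFounded using (Acc; acc)
open import Relation.Nullary using (¬_; Dec; yes; no; contradiction)
open import Relation.Nullary.Decidable using (_×-dec_)
open import Relation.Unary using (Decidable)
open import Relation.Binary using (DecidableEquality)
open import Relation.Binary.PropositionalEquality using (_≡_; _≢_; refl; sym; trans; cong; cong₂; subst; module ≡-Reasoning)
open +-*-Solver using (solve; _:=_; _:+_; _:*_; con)

module _ {A : Set} (f : A → A) where

  iter-+ : ∀ m n x → iter f (m + n) x ≡ iter f m (iter f n x)
  iter-+ zero    n x = refl
  iter-+ (suc m) n x = cong f (iter-+ m n x)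

  iter-*-fixed : ∀ {p z} → iter f p z ≡ z → ∀ k → iter f (k * p) z ≡ z
  iter-*-fixed         fix zero    = refl
  iter-*-fixed {p} {z} fix (suc k) =
    trans (iter-+ p (k * p) z) (trans (cong (iter f p) (iter-*-fixed fix k)) fix)

  PeriodicFrom : A → ℕ → ℕ → Set
  PeriodicFrom x τ p = iter f (τ + p) x ≡ iter f τ x

  periodicFrom⇒fixed : ∀ {x τ p} → PeriodicFrom x τ p → iter f p (iter f τ x) ≡ iter f τ x
  periodicFrom⇒fixed {x} {τ} {p} e =
    trans (sym (iter-+ p τ x)) (trans (cong (λ t → iter f t x) (+-comm p τ)) e)

  fixed⇒periodicFrom : ∀ {x τ p} → iter f p (iter f τ x) ≡ iter f τ x → PeriodicFrom x τ p
  fixed⇒periodicFrom {x} {τ} {p} e =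
    trans (cong (λ t → iter f t x) (+-comm τ p)) (trans (iter-+ p τ x) e)

  periodicFrom-+ : ∀ {x τ p} → PeriodicFrom x τ p → ∀ j → PeriodicFrom x (j + τ) p
  periodicFrom-+ {x} {τ} {p} e j = begin
    iter f (j + τ + p) x          ≡⟨ cong (λ t → iter f t x) (+-assoc j τ p) ⟩
    iter f (j + (τ + p)) x        ≡⟨ iter-+ j (τ + p) x ⟩
    iter f j (iter f (τ + p) x)   ≡⟨ cong (iter f j) e ⟩
    iter f j (iter f τ x)         ≡⟨ iter-+ j τ x ⟨
    iter f (j + τ) x              ∎
    where open ≡-Reasoning

  periodicFrom-later : ∀ {x τ p s} → PeriodicFrom x τ p → τ ≤ s → PeriodicFrom x s p
  periodicFrom-later {x} {τ} {p} {s} e τ≤s =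
    subst (λ t → PeriodicFrom x t p) (m∸n+n≡m τ≤s) (periodicFrom-+ {x} {τ} e (s ∸ τ))

  -- At time b * p + a ≥ b the orbit is back at iter f a x, and from time b on it repeats with lag r.
  periodicFrom-transfer : ∀ {x a p b r} → 1 ≤ p →
    PeriodicFrom x a p → PeriodicFrom x b r → PeriodicFrom x a r
  periodicFrom-transfer {x} {a} {p} {b} {r} 1≤p ea eb = fixed⇒periodicFrom {x} {a} {r} (begin
      iter f r z              ≡⟨ cong (iter f r) (sym z-at-s) ⟩
      iter f r (iter f s x)   ≡⟨ periodicFrom⇒fixed {x} {s} (periodicFrom-later {x} {b} eb b≤s) ⟩
      iter f s x              ≡⟨ z-at-s ⟩
      z                       ∎)
    where
      open ≡-Reasoning
      z = iter f a x
      s = b * p + a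
      z-at-s : iter f s x ≡ z
      z-at-s = trans (iter-+ (b * p) a x) (iter-*-fixed (periodicFrom⇒fixed {x} {a} ea) b)
      b≤s : b ≤ s
      b≤s = ≤-trans (m≤m*n b p {{>-nonZero 1≤p}}) (m≤m+n (b * p) a)

minimal : ∀ {P : ℕ → Set} → Decidable P → ∀ {k} → P k → ∃ λ m → P m × (∀ {j} → P j → m ≤ j)
minimal {P} P? {k} = search k (<-wellFounded k)
  where
    search : ∀ k → Acc _<_ k → P k → ∃ λ m → P m × (∀ {j} → P j → m ≤ j)
    search k (acc below) pk with anyUpTo? P? k
    ... | yes (j , j<k , pj) = search j (below j<k) pj
    ... | no  none           = k , pk , λ pj → ≮⇒≥ (λ j<k → none (_ , j<k , pj))

-- Periods and transients of finite networks

vec-ext : ∀ {A : Set} {n} {x y : Vec A n} → (∀ i → lookup x i ≡ lookup y i) → x ≡ y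
vec-ext {x = x} {y} e = trans (sym (tabulate∘lookup x)) (trans (tabulate-cong e) (tabulate∘lookup y))

_≟ᶜ_ : ∀ {q n} → DecidableEquality (Config q n)
_≟ᶜ_ = ≡-dec Fin._≟_

toIndex : ∀ {q n} → Config q n → Fin (q ^ n)
toIndex Vec.[]       = zero
toIndex (a Vec.∷ as) = combine a (toIndex as)

fromIndex : ∀ {q} n → Fin (q ^ n) → Config q n
fromIndex zero    _ = Vec.[]
fromIndex {q} (suc n) i = proj₁ (remQuot {q} (q ^ n) i) Vec.∷ fromIndex n (proj₂ (remQuot {q} (q ^ n) i))

fromIndex-toIndex : ∀ {q n} (x : Config q n) → fromIndex n (toIndex x) ≡ x
fromIndex-toIndex Vec.[] = refl
fromIndex-toIndex {q} {suc n} (a Vec.∷ as) =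
  cong₂ Vec._∷_ (cong proj₁ split) (trans (cong (fromIndex n ∘ proj₂) split) (fromIndex-toIndex as))
  where split = remQuot-combine {q} {q ^ n} a (toIndex as)

toIndex-fromIndex : ∀ {q} n (i : Fin (q ^ n)) → toIndex (fromIndex {q} n i) ≡ i
toIndex-fromIndex zero    zero = refl
toIndex-fromIndex {q} (suc n) i =
  trans (cong (combine (proj₁ (remQuot {q} (q ^ n) i))) (toIndex-fromIndex n _)) (combine-remQuot {q} (q ^ n) i)

toIndex-injective : ∀ {q n} → Injective _≡_ _≡_ (toIndex {q} {n})
toIndex-injective {x = x} {y} e =
  trans (sym (fromIndex-toIndex x)) (trans (cong (fromIndex _) e) (fromIndex-toIndex y))

fromIndex-injective : ∀ {q} n → Injective _≡_ _≡_ (fromIndex {q} n)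
fromIndex-injective n {i} {j} e =
  trans (sym (toIndex-fromIndex n i)) (trans (cong toIndex e) (toIndex-fromIndex n j))

eventuallyPeriodic : ∀ {q n} (F : Net q n) x → ∃₂ λ τ p → 1 ≤ p × PeriodicFrom F x τ p
eventuallyPeriodic {q} {n} F x with pigeonhole (n<1+n (q ^ n)) (λ i → toIndex (iter F (toℕ i) x))
... | i , j , i<j , e = toℕ i , toℕ j ∸ toℕ i , m<n⇒0<n∸m i<j ,
  trans (cong (λ t → iter F t x) (m+[n∸m]≡n (<⇒≤ i<j))) (sym (toIndex-injective e))

module _ {q n} (F : Net q n) (x : Config q n) {τ₀ p₀} (1≤τ₀ : 1 ≤ τ₀) (1≤p₀ : 1 ≤ p₀)
         (periodic : PeriodicFrom F x τ₀ p₀) where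

  period-exists : ∃ λ per → IsPeriod F x per × PeriodicFrom F x τ₀ per
  period-exists with minimal (λ p → (1 ≤? p) ×-dec (iter F (τ₀ + p) x ≟ᶜ iter F τ₀ x)) (1≤p₀ , periodic)
  ... | per , (1≤per , e) , least =
    per , (1≤per , (τ₀ , 1≤τ₀ , e) ,
           λ p τ 1≤p _ eτ → least (1≤p , periodicFrom-transfer F {x} {τ₀} {b = τ} 1≤p₀ periodic eτ)) , e

  transient-exists : ∃ λ τ → IsTransient F x τ × PeriodicFrom F x τ p₀
  transient-exists with minimal (λ t → (1 ≤? t) ×-dec (iter F (t + p₀) x ≟ᶜ iter F t x)) (1≤τ₀ , periodic)
  ... | τ , (1≤τ , e) , least =
    τ , (1≤τ , (p₀ , 1≤p₀ , e) ,
         λ τ′ p 1≤τ′ 1≤p eτ′ → least (1≤τ′ , periodicFrom-transfer F {x} {τ′} {b = τ₀} 1≤p eτ′ periodic)) , e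

-- Embeddings of orbit graphs

record OrbitEmbedding {q n q′ m} (T : ℕ) (F : Net q n) (H : Net q′ m) : Set where
  field
    φ           : Config q n → Config q′ m
    φ-injective : Injective _≡_ _≡_ φ
    φ-commutes  : ∀ x → iter H T (φ x) ≡ φ (F x)

module OrbitEmbeddingProperties {q n q′ m T} {F : Net q n} {H : Net q′ m} (e : OrbitEmbedding T F H) where
  open OrbitEmbedding e

  φ-iter : ∀ j x → iter H (j * T) (φ x) ≡ φ (iter F j x)
  φ-iter zero    x = refl
  φ-iter (suc j) x = begin
    iter H (T + j * T) (φ x)          ≡⟨ iter-+ H T (j * T) (φ x) ⟩
    iter H T (iter H (j * T) (φ x))   ≡⟨ cong (iter H T) (φ-iter j x) ⟩
    iter H T (φ (iter F j x))         ≡⟨ φ-commutes (iter F j x) ⟩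
    φ (F (iter F j x))                ∎
    where open ≡-Reasoning

  time-positive : ∀ {x} → F x ≢ x → 1 ≤ T
  time-positive {x} moved = n≢0⇒n>0 λ { refl → moved (sym (φ-injective (φ-commutes x))) }

  periodicFrom-push : ∀ {x i d} → PeriodicFrom F x i d → PeriodicFrom H (φ x) (i * T) (d * T)
  periodicFrom-push {x} {i} {d} e = begin
    iter H (i * T + d * T) (φ x)   ≡⟨ cong (λ t → iter H t (φ x)) (sym (*-distribʳ-+ T i d)) ⟩
    iter H ((i + d) * T) (φ x)     ≡⟨ φ-iter (i + d) x ⟩
    φ (iter F (i + d) x)           ≡⟨ cong φ e ⟩
    φ (iter F i x)                 ≡⟨ sym (φ-iter i x) ⟩
    iter H (i * T) (φ x)           ∎
    where open ≡-Reasoning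

  -- From time τ * T ≥ τ on, φ (iter F τ x) returns after p steps of H, hence after T * p
  -- steps, which are p steps of F.
  periodicFrom-pull : 1 ≤ T → ∀ {x τ p} → PeriodicFrom H (φ x) τ p → PeriodicFrom F x τ p
  periodicFrom-pull 1≤T {x} {τ} {p} e = fixed⇒periodicFrom F {x} {τ} {p} (φ-injective (begin
    φ (iter F p y)          ≡⟨ sym (φ-iter p y) ⟩
    iter H (p * T) z        ≡⟨ cong (λ t → iter H t z) (*-comm p T) ⟩
    iter H (T * p) z        ≡⟨ iter-*-fixed H z-returns T ⟩
    z                       ∎))
    where
      open ≡-Reasoning
      y = iter F τ x
      z = φ y
      z-returns : iter H p z ≡ z
      z-returns = subst (λ u → iter H p u ≡ u) (φ-iter τ x)
        (periodicFrom⇒fixed H {φ x} {τ * T}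
          (periodicFrom-later H {φ x} {τ} e (m≤m*n τ T {{>-nonZero 1≤T}})))

  eventuallyPeriodic-image : 1 ≤ T → ∀ x → ∃₂ λ τ p → 1 ≤ τ × 1 ≤ p × PeriodicFrom H (φ x) τ p
  eventuallyPeriodic-image 1≤T x with eventuallyPeriodic F x
  ... | i , d , 1≤d , e = suc i * T , d * T , *-mono-≤ {1} {suc i} (s≤s z≤n) 1≤T , *-mono-≤ 1≤d 1≤T ,
    periodicFrom-push {x} {suc i} (periodicFrom-later F {x} {i} e (n≤1+n i))

  period-≥ : 1 ≤ T → ∀ {x L} → (∀ {k p} → 1 ≤ p → PeriodicFrom F x k p → L ≤ p) →
    ∃ λ per → IsPeriod H (φ x) per × L ≤ per
  period-≥ 1≤T {x} bound with eventuallyPeriodic-image 1≤T x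
  ... | τ₀ , p₀ , 1≤τ₀ , 1≤p₀ , e with period-exists H (φ x) 1≤τ₀ 1≤p₀ e
  ... | per , isPeriod , e-per = per , isPeriod , bound {τ₀} (proj₁ isPeriod) (periodicFrom-pull 1≤T {x} {τ₀} e-per)

  transient-≥ : 1 ≤ T → ∀ {x L} → (∀ {k p} → k < L → 1 ≤ p → ¬ PeriodicFrom F x k p) →
    ∃ λ τ → IsTransient H (φ x) τ × L ≤ τ
  transient-≥ 1≤T {x} bound with eventuallyPeriodic-image 1≤T x
  ... | τ₀ , p₀ , 1≤τ₀ , 1≤p₀ , e with transient-exists H (φ x) 1≤τ₀ 1≤p₀ e
  ... | τ , isTransient , e-τ =
    τ , isTransient , ≮⇒≥ (λ τ<L → bound τ<L 1≤p₀ (periodicFrom-pull 1≤T {x} {τ} e-τ))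

embMap-injective : ∀ {qH nH qF nF} (e : BlockEmb qH nH qF nF) → Injective _≡_ _≡_ (embMap e)
embMap-injective e {x} {y} φx≡φy = vec-ext λ i →
  BlockEmb.inj e i (lookup x i) (lookup y i) λ { v refl → agree v }
  where
    agree : ∀ v → BlockEmb.pat e (lookup x (BlockEmb.blk e v)) v ≡ BlockEmb.pat e (lookup y (BlockEmb.blk e v)) v
    agree v = trans (sym (lookup∘tabulate _ v)) (trans (cong (λ z → lookup z v) φx≡φy) (lookup∘tabulate _ v))

-- Each block is nonempty, so choosing a node in every block is injective.
blockEmb-≤ : ∀ {qH nH qF nF} → BlockEmb qH nH qF nF → nH ≤ nF
blockEmb-≤ e = injective⇒≤ {f = proj₁ ∘ BlockEmb.nonempty e} λ {i} {j} eq →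
  trans (sym (proj₂ (BlockEmb.nonempty e i))) (trans (cong (BlockEmb.blk e) eq) (proj₂ (BlockEmb.nonempty e j)))

record Host (𝓕 : Family) {q n} (F : Net q n) (m T : ℕ) : Set where
  field
    alphabet  : ℕ
    network   : Net alphabet m
    member    : Member 𝓕 alphabet m network
    embedding : OrbitEmbedding T F network
    n≤m       : n ≤ m

simulates⇒host : ∀ {𝓕 R T S} → Simulates 𝓕 R T S →
  ∀ {w q n} {F : Net q n} → R w q n F → Host 𝓕 F (S n) (T n)
simulates⇒host (_ , _ , simulate) r with simulate _ _ _ _ r
... | w′ , qH , H , e , _ , rep , sim = record
  { alphabet  = qH
  ; network   = H
  ; member    = w′ , rep
  ; embedding = record { φ = embMap e ; φ-injective = embMap-injective e ; φ-commutes = sym ∘ sim }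
  ; n≤m       = blockEmb-≤ e
  }

-- Disjoint periodic orbits

module _ {q m} (H : Net q m) (P : ℕ) .{{_ : NonZero P}} where

  Returns : Config q m → Set
  Returns z = iter H P z ≡ z

  Reaches : Config q m → Config q m → Set
  Reaches k z = ∃ λ i → i < P × iter H i k ≡ z

  reaches? : ∀ k z → Dec (Reaches k z)
  reaches? k z = anyUpTo? (λ i → iter H i k ≟ᶜ z) P

  returns-mod : ∀ {k} → Returns k → ∀ e → iter H (e % P) k ≡ iter H e k
  returns-mod {k} r e = begin
    iter H (e % P) k                       ≡⟨ cong (iter H (e % P)) (sym (iter-*-fixed H r (e / P))) ⟩
    iter H (e % P) (iter H (e / P * P) k)  ≡⟨ sym (iter-+ H (e % P) (e / P * P) k) ⟩
    iter H (e % P + e / P * P) k           ≡⟨ cong (λ t → iter H t k) (sym (m≡m%n+[m/n]*n e P)) ⟩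
    iter H e k                             ∎
    where open ≡-Reasoning

  -- Going on for pred P * i steps from the meeting point closes the orbit of z.
  meet⇒reaches : ∀ {z k} → Returns z → Returns k → ∀ i j → iter H i z ≡ iter H j k → Reaches k z
  meet⇒reaches {z} {k} rz rk i j meet = e % P , m%n<n e P , trans (returns-mod rk e) (begin
    iter H (pred P * i + j) k            ≡⟨ iter-+ H (pred P * i) j k ⟩
    iter H (pred P * i) (iter H j k)     ≡⟨ cong (iter H (pred P * i)) (sym meet) ⟩
    iter H (pred P * i) (iter H i z)     ≡⟨ sym (iter-+ H (pred P * i) i z) ⟩
    iter H (pred P * i + i) z            ≡⟨ cong (λ t → iter H t z) P*i ⟩
    iter H (i * P) z                     ≡⟨ iter-*-fixed H rz i ⟩
    z                                    ∎)
    where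
      open ≡-Reasoning
      e = pred P * i + j
      P*i : pred P * i + i ≡ i * P
      P*i = trans (+-comm (pred P * i) i) (trans (cong (_* i) (suc-pred P)) (*-comm P i))

  disjoint-from : ∀ {z} → Returns z → ∀ {ks} → All Returns ks → ¬ Any (λ k → Reaches k z) ks →
    All (DisjointOrbits H z) ks
  disjoint-from rz []         unreached = []
  disjoint-from rz (rk ∷ rks) unreached =
    (λ i j meet → unreached (here (meet⇒reaches rz rk i j meet))) ∷ disjoint-from rz rks (unreached ∘ there)

  record Representatives (zs : List (Config q m)) : Set where
    field
      reps      : List (Config q m)
      returning : All Returns reps
      disjoint  : PairwiseDisjoint H reps
      covering  : All (λ z → Any (λ k → Reaches k z) reps) zs

  representatives : ∀ zs → All Returns zs → Representatives zs
  representatives []       []         = record { reps = [] ; returning = [] ; disjoint = tt ; covering = [] }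
  representatives (z ∷ zs) (rz ∷ rzs) with representatives zs rzs
  ... | R with any? (λ k → reaches? k z) (Representatives.reps R)
  ...   | yes reached = record
    { reps = reps ; returning = returning ; disjoint = disjoint ; covering = reached ∷ covering }
    where open Representatives R
  ...   | no unreached = record
    { reps      = z ∷ reps
    ; returning = rz ∷ returning
    ; disjoint  = disjoint-from rz returning unreached , disjoint
    ; covering  = here (0 , >-nonZero⁻¹ P , refl) ∷ All.map there covering
    }
    where open Representatives R

  -- Every point is determined by the representative reaching it and the number of steps taken.
  covered-≤ : ∀ {N} {g : Fin N → Config q m} → Injective _≡_ _≡_ g →
    ∀ ks → (∀ i → Any (λ k → Reaches k (g i)) ks) → N ≤ length ks * P
  covered-≤ {N} {g} g-injective ks cover = injective⇒≤ {f = code} code-injective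
    where
      rep : Fin N → Fin (length ks)
      rep i = Any.index (cover i)
      steps : ∀ i → ∃ λ s → s < P × iter H s (List.lookup ks (rep i)) ≡ g i
      steps i = lookup-index (cover i)
      code : Fin N → Fin (length ks * P)
      code i = combine (rep i) (fromℕ< (proj₁ (proj₂ (steps i))))
      code-injective : Injective _≡_ _≡_ code
      code-injective {i} {j} eq with combine-injective (rep i) _ (rep j) _ eq
      ... | same-rep , same-steps = g-injective (begin
        g i                                                    ≡⟨ sym (proj₂ (proj₂ (steps i))) ⟩
        iter H (proj₁ (steps i)) (List.lookup ks (rep i))      ≡⟨ cong₂ (λ s r → iter H s (List.lookup ks r)) s≡ same-rep ⟩
        iter H (proj₁ (steps j)) (List.lookup ks (rep j))      ≡⟨ proj₂ (proj₂ (steps j)) ⟩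
        g j                                                    ∎)
        where
          open ≡-Reasoning
          s≡ : proj₁ (steps i) ≡ proj₁ (steps j)
          s≡ = trans (sym (toℕ-fromℕ< _)) (trans (cong toℕ same-steps) (toℕ-fromℕ< _))

  disjointOrbits-≥ : ∀ {N} (g : Fin N → Config q m) → Injective _≡_ _≡_ g → (∀ i → Returns (g i)) →
    ∃ λ ks → N ≤ length ks * P × All Returns ks × PairwiseDisjoint H ks
  disjointOrbits-≥ {N} g g-injective g-returns =
    reps , covered-≤ g-injective reps (tabulate⁻ covering) , returning , disjoint
    where open Representatives (representatives (List.tabulate g) (tabulate⁺ g-returns))

involution⇒disjointOrbits : ∀ {q n q′ m T} {F : Net q n} {H : Net q′ m} → OrbitEmbedding T F H →
  (∀ x → F (F x) ≡ x) → 1 ≤ T →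
  ∃ λ xs → q ^ n ≤ length xs * (2 * T) × All (PeriodicLe H (2 * T)) xs × PairwiseDisjoint H xs
involution⇒disjointOrbits {n = n} {T = T} {F} {H} e involutive 1≤T =
  let xs , count , returning , disjoint =
        disjointOrbits-≥ H (2 * T) {{>-nonZero 1≤2T}} (φ ∘ fromIndex n)
          (fromIndex-injective n ∘ φ-injective) (λ i → trans (φ-iter 2 _) (cong φ (involutive _)))
  in xs , count , All.map (λ r → 2 * T , 1≤2T , ≤-refl , r) returning , disjoint
  where
    open OrbitEmbedding e
    open OrbitEmbeddingProperties e
    1≤2T = ≤-trans 1≤T (m≤n*m T 2)

-- A pipelined binary counter and a flipper

prev : ∀ {n} → Fin n → Fin n
prev zero    = zero
prev (suc v) = inject₁ v

Rule : ℕ → ℕ → Set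
Rule q n = Fin n → Fin q → Fin q → Fin q

local : ∀ {q n} → Rule q n → Net q n
local g x = tabulate λ v → g v (lookup x v) (lookup x (prev v))

lookup-local : ∀ {q n} (g : Rule q n) x v → lookup (local g x) v ≡ g v (lookup x v) (lookup x (prev v))
lookup-local g x v = lookup∘tabulate _ v

zeros : ∀ {q n} → Config (suc q) n
zeros = replicate _ zero

Cell : Set
Cell = Fin 4

digit carry : Cell → Bool
digit zero                   = false
digit (suc zero)             = true
digit (suc (suc zero))       = false
digit (suc (suc (suc zero))) = true
carry zero                   = false
carry (suc zero)             = false
carry (suc (suc zero))       = true
carry (suc (suc (suc zero))) = true

cell : Bool → Bool → Cell
cell false false = zero
cell true  false = suc zero
cell false true  = suc (suc zero)
cell true  true  = suc (suc (suc zero))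

digit-cell : ∀ d k → digit (cell d k) ≡ d
digit-cell false false = refl
digit-cell true  false = refl
digit-cell false true  = refl
digit-cell true  true  = refl

carry-cell : ∀ d k → carry (cell d k) ≡ k
carry-cell false false = refl
carry-cell true  false = refl
carry-cell false true  = refl
carry-cell true  true  = refl

bitValue : Bool → ℕ
bitValue false = 0
bitValue true  = 1

halfAdder : ∀ a b → bitValue (a xor b) + 2 * bitValue (a ∧ b) ≡ bitValue a + bitValue b
halfAdder false false = refl
halfAdder false true  = refl
halfAdder true  false = refl
halfAdder true  true  = refl

halfAdd overflow : Bool → Cell → Cell
halfAdd  c s = cell (digit s xor c) (digit s ∧ c)
overflow c s = cell (digit s ∨ c) false

-- A cell holds a digit and a pending carry. A tick adds the incoming carry to the digit and hands
-- the old carry on, so carries travel one cell per step and every node reads only its predecessor.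
-- The last cell records whether a carry ever reached it.
tick : ∀ {n} → Bool → Vec Cell (suc n) → Vec Cell (suc n)
tick {zero}  c (s ∷ []) = overflow c s ∷ []
tick {suc n} c (s ∷ ss) = halfAdd c s ∷ tick (carry s) ss

value : ∀ {n} → Vec Cell (suc n) → ℕ
value {zero}  _        = 0
value {suc n} (s ∷ ss) = bitValue (digit s) + 2 * (bitValue (carry s) + value ss)

carryOut : ∀ {n} → Bool → Vec Cell (suc n) → Bool
carryOut {zero}  c _        = c
carryOut {suc n} c (s ∷ ss) = carryOut (carry s) ss

flag : ∀ {n} → Vec Cell (suc n) → Bool
flag {zero}  (s ∷ []) = digit s
flag {suc n} (s ∷ ss) = flag ss

value-tick : ∀ n c (ss : Vec Cell (suc n)) →
  value (tick c ss) + 2 ^ n * bitValue (carryOut c ss) ≡ value ss + bitValue c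
value-tick zero    c (s ∷ []) = +-identityʳ (bitValue c)
value-tick (suc n) c (s ∷ ss) = begin
  bitValue (digit s′) + 2 * (bitValue (carry s′) + value (tick (carry s) ss)) + 2 * 2 ^ n * bitValue o
    ≡⟨ solve 5 (λ a b v k o → a :+ con 2 :* (b :+ v) :+ con 2 :* k :* o := (a :+ con 2 :* b) :+ con 2 :* (v :+ k :* o))
         refl (bitValue (digit s′)) (bitValue (carry s′)) (value (tick (carry s) ss)) (2 ^ n) (bitValue o) ⟩
  (bitValue (digit s′) + 2 * bitValue (carry s′)) + 2 * (value (tick (carry s) ss) + 2 ^ n * bitValue o)
    ≡⟨ cong₂ (λ a b → a + 2 * b) half-adder (value-tick n (carry s) ss) ⟩
  (bitValue (digit s) + bitValue c) + 2 * (value ss + bitValue (carry s))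
    ≡⟨ solve 4 (λ a c v k → (a :+ c) :+ con 2 :* (v :+ k) := (a :+ con 2 :* (k :+ v)) :+ c)
         refl (bitValue (digit s)) (bitValue c) (value ss) (bitValue (carry s)) ⟩
  bitValue (digit s) + 2 * (bitValue (carry s) + value ss) + bitValue c ∎
  where
    open ≡-Reasoning
    s′ = halfAdd c s
    o  = carryOut (carry s) ss
    half-adder : bitValue (digit s′) + 2 * bitValue (carry s′) ≡ bitValue (digit s) + bitValue c
    half-adder = trans (cong₂ (λ d k → bitValue d + 2 * bitValue k)
                         (digit-cell (digit s xor c) (digit s ∧ c)) (carry-cell (digit s xor c) (digit s ∧ c)))
                       (halfAdder (digit s) c)

flag-tick : ∀ n c (ss : Vec Cell (suc n)) → flag (tick c ss) ≡ flag ss ∨ carryOut c ss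
flag-tick zero    c (s ∷ []) = digit-cell (digit s ∨ c) false
flag-tick (suc n) c (s ∷ ss) = flag-tick n (carry s) ss

carryIn : ∀ {n} → Bool → Fin n → Cell → Bool
carryIn c zero    _ = c
carryIn c (suc v) t = carry t

tickRule : ∀ n → Bool → Rule 4 (suc n)
tickRule n c v s t = if toℕ v ≡ᵇ n then overflow (carryIn c v t) s else halfAdd (carryIn c v t) s

lookup-tick : ∀ n c (ss : Vec Cell (suc n)) v → lookup (tick c ss) v ≡ tickRule n c v (lookup ss v) (lookup ss (prev v))
lookup-tick zero    c (s ∷ []) zero          = refl
lookup-tick (suc n) c (s ∷ ss) zero          = refl
lookup-tick (suc n) c (s ∷ ss) (suc zero)    = lookup-tick n (carry s) ss zero
lookup-tick (suc n) c (s ∷ ss) (suc (suc v)) = lookup-tick n (carry s) ss (suc v)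

counterRule : ∀ n → Rule 4 (suc n)
counterRule n = tickRule n true

counter : ∀ n → Net 4 (suc n)
counter n = local (counterRule n)

counter≡tick : ∀ n x → counter n x ≡ tick true x
counter≡tick n x = vec-ext λ v → trans (lookup-local (counterRule n) x v) (sym (lookup-tick n true x v))

positive-multiple-≥ : ∀ K a b p → K * b ≡ K * a + p → 1 ≤ p → K ≤ p
positive-multiple-≥ K a b p eq 1≤p = subst (K ≤_) (sym p≡K*[b∸a]) (m≤m*n K (b ∸ a) {{b∸a≢0}})
  where
    p≡K*[b∸a] : p ≡ K * (b ∸ a)
    p≡K*[b∸a] = trans (sym (m+n∸m≡n (K * a) p))
                  (trans (cong (_∸ K * a) (sym eq)) (sym (*-distribˡ-∸ K b a)))
    b∸a≢0 : NonZero (b ∸ a)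
    b∸a≢0 = m*n≢0⇒n≢0 K {{subst NonZero p≡K*[b∸a] (>-nonZero 1≤p)}}

value-zeros : ∀ n → value (zeros {3} {suc n}) ≡ 0
value-zeros zero    = refl
value-zeros (suc n) = cong (2 *_) (value-zeros n)

flag-zeros : ∀ n → flag (zeros {3} {suc n}) ≡ false
flag-zeros zero    = refl
flag-zeros (suc n) = flag-zeros n

module Counter (n : ℕ) where

  state : ℕ → Vec Cell (suc n)
  state t = iter (counter n) t zeros

  overflows : ℕ → ℕ
  overflows zero    = 0
  overflows (suc t) = overflows t + bitValue (carryOut true (state t))

  value+overflows : ∀ t → value (state t) + 2 ^ n * overflows t ≡ t
  value+overflows zero    = cong₂ _+_ (value-zeros n) (*-zeroʳ (2 ^ n))
  value+overflows (suc t) = begin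
    value (counter n s) + 2 ^ n * (overflows t + bitValue o)
      ≡⟨ cong (λ s′ → value s′ + 2 ^ n * (overflows t + bitValue o)) (counter≡tick n s) ⟩
    value (tick true s) + 2 ^ n * (overflows t + bitValue o)
      ≡⟨ solve 4 (λ v k d b → v :+ k :* (d :+ b) := (v :+ k :* b) :+ k :* d)
           refl (value (tick true s)) (2 ^ n) (overflows t) (bitValue o) ⟩
    (value (tick true s) + 2 ^ n * bitValue o) + 2 ^ n * overflows t
      ≡⟨ cong (_+ 2 ^ n * overflows t) (value-tick n true s) ⟩
    value s + 1 + 2 ^ n * overflows t
      ≡⟨ solve 2 (λ v d → v :+ con 1 :+ d := con 1 :+ (v :+ d)) refl (value s) (2 ^ n * overflows t) ⟩
    suc (value s + 2 ^ n * overflows t)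
      ≡⟨ cong suc (value+overflows t) ⟩
    suc t ∎
    where
      open ≡-Reasoning
      s = state t
      o = carryOut true s

  flag-state : ∀ t → flag (state t) ≡ not (overflows t ≡ᵇ 0)
  flag-state zero    = flag-zeros n
  flag-state (suc t) = begin
    flag (counter n s)                         ≡⟨ cong flag (counter≡tick n s) ⟩
    flag (tick true s)                         ≡⟨ flag-tick n true s ⟩
    flag s ∨ o                                 ≡⟨ cong (_∨ o) (flag-state t) ⟩
    not (overflows t ≡ᵇ 0) ∨ o                 ≡⟨ one-more o ⟩
    not (overflows t + bitValue o ≡ᵇ 0)        ∎
    where
      open ≡-Reasoning
      s = state t
      o = carryOut true s
      one-more : ∀ b → not (overflows t ≡ᵇ 0) ∨ b ≡ not (overflows t + bitValue b ≡ᵇ 0)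
      one-more false rewrite +-identityʳ (overflows t) = ∨-identityʳ _
      one-more true  rewrite +-comm (overflows t) 1    = ∨-zeroʳ _

  period-≥ : ∀ {k p} → 1 ≤ p → PeriodicFrom (counter n) zeros k p → 2 ^ n ≤ p
  period-≥ {k} {p} 1≤p e = positive-multiple-≥ (2 ^ n) (overflows k) (overflows (k + p)) p
    (+-cancelˡ-≡ (value (state k)) _ _ (begin
      value (state k) + 2 ^ n * overflows (k + p)         ≡⟨ cong (λ s → value s + 2 ^ n * overflows (k + p)) (sym e) ⟩
      value (state (k + p)) + 2 ^ n * overflows (k + p)   ≡⟨ value+overflows (k + p) ⟩
      k + p                                               ≡⟨ cong (_+ p) (sym (value+overflows k)) ⟩
      value (state k) + 2 ^ n * overflows k + p           ≡⟨ +-assoc (value (state k)) _ p ⟩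
      value (state k) + (2 ^ n * overflows k + p)         ∎)) 1≤p
    where open ≡-Reasoning

  no-overflow-before : ∀ {k} → k < 2 ^ n → overflows k ≡ 0
  no-overflow-before {k} k<2ⁿ = n<1⇒n≡0 (*-cancelˡ-< (2 ^ n) _ _ (begin-strict
    2 ^ n * overflows k           ≤⟨ m≤n+m _ (value (state k)) ⟩
    value (state k) + 2 ^ n * overflows k ≡⟨ value+overflows k ⟩
    k                             <⟨ k<2ⁿ ⟩
    2 ^ n                         ≡⟨ sym (*-identityʳ (2 ^ n)) ⟩
    2 ^ n * 1                     ∎))
    where open ≤-Reasoning

  flag-down⇒no-overflow : ∀ t → flag (state t) ≡ false → overflows t ≡ 0
  flag-down⇒no-overflow t down with overflows t | flag-state t
  ... | zero  | _  = refl
  ... | suc _ | up = contradiction (trans (sym up) down) λ ()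

  -- Before the first overflow the flag is down, so the orbit cannot have closed: its value is
  -- then the number of steps taken.
  transient-≥ : ∀ {k p} → k < 2 ^ n → 1 ≤ p → ¬ PeriodicFrom (counter n) zeros k p
  transient-≥ {k} {p} k<2ⁿ 1≤p e = <⇒≢ 1≤p (sym (+-cancelˡ-≡ k p 0 (begin
    k + p                                               ≡⟨ sym (value+overflows (k + p)) ⟩
    value (state (k + p)) + 2 ^ n * overflows (k + p)   ≡⟨ cong₂ (λ s o → value s + 2 ^ n * o) e
                                                             (trans (flag-down⇒no-overflow (k + p) down) (sym none)) ⟩
    value (state k) + 2 ^ n * overflows k               ≡⟨ value+overflows k ⟩
    k                                                   ≡⟨ +-identityʳ k ⟨
    k + 0                                               ∎)))
    where
      open ≡-Reasoning
      none = no-overflow-before k<2ⁿ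
      down : flag (state (k + p)) ≡ false
      down = trans (cong flag e) (trans (flag-state k) (cong (λ o → not (o ≡ᵇ 0)) none))

counter-moves : ∀ n → counter n zeros ≢ zeros
counter-moves n = Counter.transient-≥ n {0} {1} (m^n>0 2 n) (s≤s z≤n)

flip : Cell → Cell
flip zero                   = suc zero
flip (suc zero)             = zero
flip (suc (suc zero))       = suc (suc (suc zero))
flip (suc (suc (suc zero))) = suc (suc zero)

flip-involutive : ∀ s → flip (flip s) ≡ s
flip-involutive zero                   = refl
flip-involutive (suc zero)             = refl
flip-involutive (suc (suc zero))       = refl
flip-involutive (suc (suc (suc zero))) = refl

flipRule : ∀ {n} → Rule 4 n
flipRule zero    s _ = flip s
flipRule (suc _) s _ = s

flipRule-involutive : ∀ {n} (v : Fin n) s t t′ → flipRule v (flipRule v s t) t′ ≡ s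
flipRule-involutive zero    s _ _ = flip-involutive s
flipRule-involutive (suc _) s _ _ = refl

flipper : ∀ n → Net 4 (suc n)
flipper n = local flipRule

flipper-involutive : ∀ n x → flipper n (flipper n x) ≡ x
flipper-involutive n x = vec-ext λ v → begin
  lookup (flipper n y) v                       ≡⟨ lookup-local flipRule y v ⟩
  flipRule v (lookup y v) (lookup y (prev v))  ≡⟨ cong (λ s → flipRule v s (lookup y (prev v))) (lookup-local flipRule x v) ⟩
  flipRule v (flipRule v (lookup x v) (lookup x (prev v))) (lookup y (prev v))
                                               ≡⟨ flipRule-involutive v (lookup x v) (lookup x (prev v)) (lookup y (prev v)) ⟩
  lookup x v                                   ∎
  where
    open ≡-Reasoning
    y = flipper n x

flipper-moves : ∀ n → flipper n zeros ≢ zeros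
flipper-moves n e with cong (λ x → lookup x zero) e
... | ()

-- Circuits for local networks

data Connective : Set where
  and or : Connective

apply : Connective → Bool → Bool → Bool
apply and = _∧_
apply or  = _∨_

gate : ∀ {m} → Connective → Fin m → Fin m → Gate m
gate and = AND
gate or  = OR

evalGate-gate : ∀ {m} c (i j : Fin m) w → evalGate (gate c i j) w ≡ apply c (w i) (w j)
evalGate-gate and i j w = refl
evalGate-gate or  i j w = refl

data Formula (k : ℕ) : Set where
  var : Fin k → Formula k
  bin : Connective → Formula k → Formula k → Formula k
  neg : Formula k → Formula k

⟦_⟧ : ∀ {k} → Formula k → (Fin k → Bool) → Bool
⟦ var j     ⟧ ρ = ρ j
⟦ bin c a b ⟧ ρ = apply c (⟦ a ⟧ ρ) (⟦ b ⟧ ρ)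
⟦ neg a     ⟧ ρ = not (⟦ a ⟧ ρ)

formulaSize : ∀ {k} → Formula k → ℕ
formulaSize (var j)     = 0
formulaSize (bin c a b) = suc (formulaSize a + formulaSize b)
formulaSize (neg a)     = suc (formulaSize a)

data _≼_ {k : ℕ} : ∀ {m m′} → Gates k m → Gates k m′ → Set where
  ≼-refl : ∀ {m} {gs : Gates k m} → gs ≼ gs
  ≼-step : ∀ {m m′} {gs : Gates k m} {gs′ : Gates k m′} {g : Gate m′} → gs ≼ gs′ → gs ≼ (gs′ ▷ g)

≼-trans : ∀ {k m₁ m₂ m₃} {a : Gates k m₁} {b : Gates k m₂} {c : Gates k m₃} → a ≼ b → b ≼ c → a ≼ c
≼-trans a≼b ≼-refl       = a≼b
≼-trans a≼b (≼-step b≼c) = ≼-step (≼-trans a≼b b≼c)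

weaken : ∀ {k m m′} {gs : Gates k m} {gs′ : Gates k m′} → gs ≼ gs′ → Fin m → Fin m′
weaken ≼-refl     i = i
weaken (≼-step p) i = suc (weaken p i)

wires-weaken : ∀ {k m m′} {gs : Gates k m} {gs′ : Gates k m′} (p : gs ≼ gs′) ρ i →
  wires gs′ ρ (weaken p i) ≡ wires gs ρ i
wires-weaken ≼-refl     ρ i = refl
wires-weaken (≼-step p) ρ i = wires-weaken p ρ i

input : ∀ {k m} → Gates k m → Fin k → Fin m
input []       j = j
input (gs ▷ g) j = suc (input gs j)

wires-input : ∀ {k m} (gs : Gates k m) ρ j → wires gs ρ (input gs j) ≡ ρ j
wires-input []       ρ j = refl
wires-input (gs ▷ g) ρ j = wires-input gs ρ j

record Compiled {k m : ℕ} (gs : Gates k m) (f : Formula k) : Set where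
  field
    {width}  : ℕ
    gates    : Gates k width
    extends  : gs ≼ gates
    output   : Fin width
    correct  : ∀ ρ → wires gates ρ output ≡ ⟦ f ⟧ ρ
    count    : gateCount gates ≡ formulaSize f + gateCount gs

compile : ∀ {k m} (gs : Gates k m) (f : Formula k) → Compiled gs f
compile gs (var j) = record
  { gates = gs ; extends = ≼-refl ; output = input gs j ; correct = λ ρ → wires-input gs ρ j ; count = refl }
compile gs (bin c a b) = record
  { gates   = gates B ▷ gate c (weaken (extends B) (output A)) (output B)
  ; extends = ≼-step (≼-trans (extends A) (extends B))
  ; output  = zero
  ; correct = λ ρ → trans (evalGate-gate c _ _ (wires (gates B) ρ))
      (cong₂ (apply c) (trans (wires-weaken (extends B) ρ (output A)) (correct A ρ)) (correct B ρ))
  ; count   = cong suc (begin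
      gateCount (gates B)                               ≡⟨ count B ⟩
      formulaSize b + gateCount (gates A)               ≡⟨ cong (formulaSize b +_) (count A) ⟩
      formulaSize b + (formulaSize a + gateCount gs)    ≡⟨ +-assoc (formulaSize b) _ _ ⟨
      formulaSize b + formulaSize a + gateCount gs      ≡⟨ cong (_+ gateCount gs) (+-comm (formulaSize b) _) ⟩
      formulaSize a + formulaSize b + gateCount gs      ∎)
  }
  where
    open Compiled
    open ≡-Reasoning
    A = compile gs a
    B = compile (gates A) b
compile gs (neg a) = record
  { gates = gates A ▷ NOT (output A) ; extends = ≼-step (extends A) ; output = zero
  ; correct = λ ρ → cong not (correct A ρ) ; count = cong suc (count A) }
  where
    open Compiled
    A = compile gs a

record CompiledAll {k m : ℕ} (gs : Gates k m) (j : ℕ) (fs : Fin j → Formula k) (K : ℕ) : Set where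
  field
    {width}  : ℕ
    gates    : Gates k width
    extends  : gs ≼ gates
    outputs  : Fin j → Fin width
    correct  : ∀ ρ i → wires gates ρ (outputs i) ≡ ⟦ fs i ⟧ ρ
    count    : gateCount gates ≤ j * K + gateCount gs

compileAll : ∀ {k m} (gs : Gates k m) j (fs : Fin j → Formula k) K → (∀ i → formulaSize (fs i) ≤ K) →
  CompiledAll gs j fs K
compileAll gs zero fs K bounded = record
  { gates = gs ; extends = ≼-refl ; outputs = λ () ; correct = λ ρ () ; count = ≤-refl }
compileAll gs (suc j) fs K bounded = record
  { gates   = CompiledAll.gates R
  ; extends = ≼-trans (Compiled.extends F) (CompiledAll.extends R)
  ; outputs = outputs
  ; correct = correct
  ; count   = begin
      gateCount (CompiledAll.gates R)               ≤⟨ CompiledAll.count R ⟩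
      j * K + gateCount (Compiled.gates F)          ≡⟨ cong (j * K +_) (Compiled.count F) ⟩
      j * K + (formulaSize (fs zero) + gateCount gs) ≤⟨ +-monoʳ-≤ (j * K) (+-monoˡ-≤ (gateCount gs) (bounded zero)) ⟩
      j * K + (K + gateCount gs)                    ≡⟨ +-assoc (j * K) K _ ⟨
      j * K + K + gateCount gs                      ≡⟨ cong (_+ gateCount gs) (+-comm (j * K) K) ⟩
      suc j * K + gateCount gs                      ∎
  }
  where
    open ≤-Reasoning
    F = compile gs (fs zero)
    R = compileAll (Compiled.gates F) j (fs ∘ suc) K (bounded ∘ suc)
    outputs : Fin (suc j) → Fin (CompiledAll.width R)
    outputs zero    = weaken (CompiledAll.extends R) (Compiled.output F)
    outputs (suc i) = CompiledAll.outputs R i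
    correct : ∀ ρ i → wires (CompiledAll.gates R) ρ (outputs i) ≡ ⟦ fs i ⟧ ρ
    correct ρ zero    = trans (wires-weaken (CompiledAll.extends R) ρ (Compiled.output F)) (Compiled.correct F ρ)
    correct ρ (suc i) = CompiledAll.correct R ρ i

⋁ᶠ : ∀ {k} j → (Fin (suc j) → Formula k) → Formula k
⋁ᶠ zero    f = f zero
⋁ᶠ (suc j) f = bin or (f zero) (⋁ᶠ j (f ∘ suc))

⋁ᵇ : ∀ j → (Fin (suc j) → Bool) → Bool
⋁ᵇ zero    h = h zero
⋁ᵇ (suc j) h = h zero ∨ ⋁ᵇ j (h ∘ suc)

⟦⋁ᶠ⟧ : ∀ {k} j (f : Fin (suc j) → Formula k) ρ → ⟦ ⋁ᶠ j f ⟧ ρ ≡ ⋁ᵇ j (λ s → ⟦ f s ⟧ ρ)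
⟦⋁ᶠ⟧ zero    f ρ = refl
⟦⋁ᶠ⟧ (suc j) f ρ = cong (⟦ f zero ⟧ ρ ∨_) (⟦⋁ᶠ⟧ j (f ∘ suc) ρ)

⋁ᶠ-size : ∀ {k} j (f : Fin (suc j) → Formula k) K → (∀ s → formulaSize (f s) ≤ K) →
  formulaSize (⋁ᶠ j f) ≤ j + suc j * K
⋁ᶠ-size zero    f K bounded = ≤-trans (bounded zero) (≤-reflexive (sym (+-identityʳ K)))
⋁ᶠ-size (suc j) f K bounded = s≤s (begin
  formulaSize (f zero) + formulaSize (⋁ᶠ j (f ∘ suc)) ≤⟨ +-mono-≤ (bounded zero) (⋁ᶠ-size j (f ∘ suc) K (bounded ∘ suc)) ⟩
  K + (j + suc j * K)                                 ≡⟨ solve 2 (λ K j → K :+ (j :+ (con 1 :+ j) :* K) := j :+ (K :+ (con 1 :+ j) :* K)) refl K j ⟩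
  j + suc (suc j) * K                                 ∎)
  where open ≤-Reasoning

⋁ᵇ-false : ∀ j → ⋁ᵇ j (λ _ → false) ≡ false
⋁ᵇ-false zero    = refl
⋁ᵇ-false (suc j) = ⋁ᵇ-false j

⋁ᵇ-select : ∀ j (c : Fin (suc j)) (h : Fin (suc j) → Bool) → ⋁ᵇ j (λ s → (toℕ c ≡ᵇ toℕ s) ∧ h s) ≡ h c
⋁ᵇ-select zero    zero    h = refl
⋁ᵇ-select (suc j) zero    h = trans (cong (h zero ∨_) (⋁ᵇ-false j)) (∨-identityʳ (h zero))
⋁ᵇ-select (suc j) (suc c) h = ⋁ᵇ-select j c (h ∘ suc)

⋁ᵇ-∧ˡ : ∀ j a (h : Fin (suc j) → Bool) → ⋁ᵇ j (λ s → a ∧ h s) ≡ a ∧ ⋁ᵇ j h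
⋁ᵇ-∧ˡ zero    a h = refl
⋁ᵇ-∧ˡ (suc j) a h = trans (cong ((a ∧ h zero) ∨_) (⋁ᵇ-∧ˡ j a (h ∘ suc))) (sym (∧-distribˡ-∨ a (h zero) _))

⋁ᵇ-cong : ∀ j {h h′ : Fin (suc j) → Bool} → (∀ s → h s ≡ h′ s) → ⋁ᵇ j h ≡ ⋁ᵇ j h′
⋁ᵇ-cong zero    e = e zero
⋁ᵇ-cong (suc j) e = cong₂ _∨_ (e zero) (⋁ᵇ-cong j (e ∘ suc))

oneHot-combine : ∀ {q n} (x : Config q n) v s → oneHot x (combine v s) ≡ (toℕ (lookup x v) ≡ᵇ toℕ s)
oneHot-combine {q} {n} x v s = cong (λ r → toℕ (lookup x (proj₁ r)) ≡ᵇ toℕ (proj₂ r)) (remQuot-combine {n} {q} v s)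

outputBitSize : ℕ → ℕ
outputBitSize q′ = q′ + suc q′ * (q′ + suc q′ * 2)

-- Output bit (v , a) of the one-hot encoding is the disjunction, over all states s of v and t
-- of prev v with g v s t = a, of x[v]=s ∧ x[prev v]=t; the other pairs contribute an unsatisfiable
-- conjunction so that every output has the same shape.
module LocalCircuit {q′ n : ℕ} (g : Rule (suc q′) n) where

  q = suc q′

  yields : Fin n → Fin q → Fin q → Fin q → Bool
  yields v a s t = toℕ (g v s t) ≡ᵇ toℕ a

  term : Fin n → Fin q → Fin q → Fin q → Formula (n * q)
  term v a s t = if yields v a s t
    then bin and (var (combine v s)) (var (combine (prev v) t))
    else bin and (var (combine v zero)) (neg (var (combine v zero)))

  term-size : ∀ v a s t → formulaSize (term v a s t) ≤ 2
  term-size v a s t with yields v a s t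
  ... | true  = s≤s z≤n
  ... | false = ≤-refl

  ⟦term⟧ : ∀ x v a s t → ⟦ term v a s t ⟧ (oneHot x) ≡
    (toℕ (lookup x v) ≡ᵇ toℕ s) ∧ ((toℕ (lookup x (prev v)) ≡ᵇ toℕ t) ∧ yields v a s t)
  ⟦term⟧ x v a s t with yields v a s t
  ... | true  = trans (cong₂ _∧_ (oneHot-combine x v s) (oneHot-combine x (prev v) t))
                      (cong ((toℕ (lookup x v) ≡ᵇ toℕ s) ∧_) (sym (∧-identityʳ _)))
  ... | false = trans (∧-inverseʳ (oneHot x (combine v zero)))
                      (sym (trans (cong ((toℕ (lookup x v) ≡ᵇ toℕ s) ∧_) (∧-zeroʳ _)) (∧-zeroʳ _)))

  outputBit : Fin n → Fin q → Formula (n * q)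
  outputBit v a = ⋁ᶠ q′ λ s → ⋁ᶠ q′ λ t → term v a s t

  outputBit-size : ∀ v a → formulaSize (outputBit v a) ≤ outputBitSize q′
  outputBit-size v a = ⋁ᶠ-size q′ _ _ λ s → ⋁ᶠ-size q′ _ 2 (term-size v a s)

  ⟦outputBit⟧ : ∀ x v a → ⟦ outputBit v a ⟧ (oneHot x) ≡ yields v a (lookup x v) (lookup x (prev v))
  ⟦outputBit⟧ x v a = begin
    ⟦ outputBit v a ⟧ (oneHot x)
      ≡⟨ ⟦⋁ᶠ⟧ q′ _ (oneHot x) ⟩
    ⋁ᵇ q′ (λ s → ⟦ ⋁ᶠ q′ (term v a s) ⟧ (oneHot x))
      ≡⟨ ⋁ᵇ-cong q′ (λ s → trans (⟦⋁ᶠ⟧ q′ _ (oneHot x)) (trans (⋁ᵇ-cong q′ (⟦term⟧ x v a s)) (⋁ᵇ-∧ˡ q′ _ _))) ⟩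
    ⋁ᵇ q′ (λ s → (toℕ (lookup x v) ≡ᵇ toℕ s) ∧ ⋁ᵇ q′ (λ t → (toℕ (lookup x (prev v)) ≡ᵇ toℕ t) ∧ yields v a s t))
      ≡⟨ ⋁ᵇ-select q′ (lookup x v) _ ⟩
    ⋁ᵇ q′ (λ t → (toℕ (lookup x (prev v)) ≡ᵇ toℕ t) ∧ yields v a (lookup x v) t)
      ≡⟨ ⋁ᵇ-select q′ (lookup x (prev v)) _ ⟩
    yields v a (lookup x v) (lookup x (prev v)) ∎
    where open ≡-Reasoning

  outputBit′ : Fin (n * q) → Formula (n * q)
  outputBit′ i = outputBit (proj₁ (remQuot {n} q i)) (proj₂ (remQuot {n} q i))

  compiled : CompiledAll [] (n * q) outputBit′ (outputBitSize q′)
  compiled = compileAll [] (n * q) outputBit′ (outputBitSize q′) (λ i → outputBit-size _ _)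

  circuit : Circuit (n * q) (n * q)
  circuit = record { gates = CompiledAll.gates compiled ; out = CompiledAll.outputs compiled }

  circuit-correct : IsCircuitFor (local g) circuit
  circuit-correct x i = begin
    evalC circuit (oneHot x) i                    ≡⟨ CompiledAll.correct compiled (oneHot x) i ⟩
    ⟦ outputBit v a ⟧ (oneHot x)                  ≡⟨ ⟦outputBit⟧ x v a ⟩
    yields v a (lookup x v) (lookup x (prev v))   ≡⟨ cong (λ b → toℕ b ≡ᵇ toℕ a) (lookup-local g x v) ⟨
    oneHot (local g x) i                          ∎
    where
      open ≡-Reasoning
      v = proj₁ (remQuot {n} q i)
      a = proj₂ (remQuot {n} q i)

  circuit-size : size circuit ≤ n * (q * outputBitSize q′)
  circuit-size = ≤-trans (CompiledAll.count compiled) (≤-reflexive (trans (+-identityʳ _) (*-assoc n q (outputBitSize q′))))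

-- Bounded-degree descriptions

unique-≤1 : ∀ {A : Set} (P : A → Set) → (∀ {x y} → P x → P y → x ≡ y) →
  ∀ xs → Unique xs → All P xs → length xs ≤ 1
unique-≤1 P P-unique []          _                   _               = z≤n
unique-≤1 P P-unique (x ∷ [])    _                   _               = s≤s z≤n
unique-≤1 P P-unique (x ∷ y ∷ _) ((x≢y ∷ _) ∷ _)     (px ∷ py ∷ _)   = ⊥-elim (x≢y (P-unique px py))

unique-≤2 : ∀ {A : Set} (P Q : A → Set) → (∀ {x y} → P x → P y → x ≡ y) → (∀ {x y} → Q x → Q y → x ≡ y) →
  ∀ xs → Unique xs → All (λ x → P x ⊎ Q x) xs → length xs ≤ 2
unique-≤2 P Q P-unique Q-unique []              _ _ = z≤n
unique-≤2 P Q P-unique Q-unique (x ∷ [])        _ _ = s≤s z≤n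
unique-≤2 P Q P-unique Q-unique (x ∷ y ∷ [])    _ _ = s≤s (s≤s z≤n)
unique-≤2 P Q P-unique Q-unique (x ∷ y ∷ z ∷ _) ((x≢y ∷ x≢z ∷ _) ∷ (y≢z ∷ _) ∷ _) (px ∷ py ∷ pz ∷ _) =
  ⊥-elim (three px py pz)
  where
    three : P x ⊎ Q x → P y ⊎ Q y → P z ⊎ Q z → ⊥
    three (inj₁ a) (inj₁ b) _        = x≢y (P-unique a b)
    three (inj₁ a) (inj₂ b) (inj₁ c) = x≢z (P-unique a c)
    three (inj₁ a) (inj₂ b) (inj₂ c) = y≢z (Q-unique b c)
    three (inj₂ a) (inj₁ b) (inj₁ c) = y≢z (P-unique b c)
    three (inj₂ a) (inj₁ b) (inj₂ c) = x≢z (Q-unique a c)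
    three (inj₂ a) (inj₂ b) _        = x≢y (Q-unique a b)

outDeg-≤ : ∀ {n} (nb : InNbrs n) (u : Fin n) (P : Fin n → Set) {k : ℕ} →
  (∀ vs → Unique vs → All P vs → length vs ≤ k) → (∀ v → Any (_≡ u) (nb v) → P v) → outDeg nb u ≤ k
outDeg-≤ {n} nb u P short covers =
  short _ (filter⁺ (λ v → any? (Fin._≟ u) (nb v)) (allFin⁺ n))
          (All.map (covers _) (all-filter (λ v → any? (Fin._≟ u) (nb v)) (allFin n)))

selfGraph : ∀ {n} → InNbrs n
selfGraph v = v ∷ []

selfGraph-maxDeg : ∀ {n} Δ → 1 ≤ Δ → MaxDeg Δ (selfGraph {n})
selfGraph-maxDeg Δ 1≤Δ =
  (λ v → ([] ∷ []) , 1≤Δ) ,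
  λ u → ≤-trans (outDeg-≤ selfGraph u (_≡ u) (unique-≤1 (_≡ u) (λ a b → trans a (sym b))) λ { v (here e) → e }) 1≤Δ

prevGraph : ∀ {n} → InNbrs n
prevGraph zero    = zero ∷ []
prevGraph (suc v) = suc v ∷ inject₁ v ∷ []

suc≢inject₁ : ∀ {n} (v : Fin n) → suc v ≢ inject₁ v
suc≢inject₁ v e = 1+n≢n (trans (cong toℕ e) (toℕ-inject₁ v))

prevGraph-maxDeg : ∀ {n} → MaxDeg 2 (prevGraph {n})
prevGraph-maxDeg {n} = in-degree , λ u →
  outDeg-≤ prevGraph u (Reads u)
    (unique-≤2 (λ v → toℕ v ≡ toℕ u) (λ v → toℕ v ≡ suc (toℕ u))
      (λ a b → toℕ-injective (trans a (sym b))) (λ a b → toℕ-injective (trans a (sym b))))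
    (reads u)
  where
    in-degree : ∀ v → Unique (prevGraph v) × length (prevGraph v) ≤ 2
    in-degree zero    = ([] ∷ []) , s≤s z≤n
    in-degree (suc v) = ((suc≢inject₁ v ∷ []) ∷ [] ∷ []) , ≤-refl
    Reads : Fin n → Fin n → Set
    Reads u v = toℕ v ≡ toℕ u ⊎ toℕ v ≡ suc (toℕ u)
    reads : ∀ u v → Any (_≡ u) (prevGraph v) → Reads u v
    reads u zero    (here e)         = inj₁ (cong toℕ e)
    reads u (suc v) (here e)         = inj₁ (cong toℕ e)
    reads u (suc v) (there (here e)) = inj₂ (cong suc (trans (sym (toℕ-inject₁ v)) (cong toℕ e)))

prevGraph-commGraph : ∀ {q n} (g : Rule q n) → IsCommGraph (local g) prevGraph
prevGraph-commGraph g x y v agree =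
  trans (lookup-local g x v)
    (trans (cong₂ (g v) (agree v (self v)) (agree (prev v) (previous v))) (sym (lookup-local g y v)))
  where
    self : ∀ {n} (v : Fin n) → v ∈ prevGraph v
    self zero    = here refl
    self (suc v) = here refl
    previous : ∀ {n} (v : Fin n) → prev v ∈ prevGraph v
    previous zero    = here refl
    previous (suc v) = there (here refl)

local-inB : ∀ {q n} (g : Rule q n) → InB q 2 n (local g)
local-inB g = prevGraph , prevGraph-maxDeg , prevGraph-commGraph g

tableOf : ∀ {q} d → (Vec (Fin q) d → Fin q) → Table q d
tableOf zero    f = tab0 (f Vec.[])
tableOf (suc d) f = tabS λ a → tableOf d (f ∘ (a Vec.∷_))

applyT-tableOf : ∀ {q} d (f : Vec (Fin q) d → Fin q) as → applyT (tableOf d f) as ≡ f as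
applyT-tableOf zero    f Vec.[]       = refl
applyT-tableOf (suc d) f (a Vec.∷ as) = applyT-tableOf d (f ∘ (a Vec.∷_)) as

assign : ∀ {q n} (l : List (Fin n)) → Vec (Fin (suc q)) (length l) → Fin n → Fin (suc q)
assign []      _            u = zero
assign (w ∷ l) (a Vec.∷ as) u with w Fin.≟ u
... | yes _ = a
... | no  _ = assign l as u

assign-agrees : ∀ {q n} (l : List (Fin n)) (x : Config (suc q) n) {u} → u ∈ l →
  assign l (Vec.map (lookup x) (fromList l)) u ≡ lookup x u
assign-agrees (w ∷ l) x {u} u∈ with w Fin.≟ u
assign-agrees (w ∷ l) x (here refl)  | yes _ = refl
assign-agrees (w ∷ l) x (there u∈l)  | yes refl = refl
assign-agrees (w ∷ l) x (here refl)  | no w≢u = ⊥-elim (w≢u refl)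
assign-agrees (w ∷ l) x (there u∈l)  | no _ = assign-agrees l x u∈l

-- Over the empty alphabet a table without arguments would need a state as its value; a nonempty
-- node set has no configurations then, so every node may read just itself.
bDesc-of : ∀ {q Δ n} (F : Net q n) → 1 ≤ Δ → InB q Δ n F →
  Σ (BDesc q n) λ D → MaxDeg Δ (BDesc.nb D) × (∀ x → F x ≡ netOf D x)
bDesc-of {zero} {n = zero} F 1≤Δ (nb , maxDeg , _) =
  record { nb = nb ; tbl = λ () } , maxDeg , λ x → vec-ext λ ()
bDesc-of {zero} {Δ} {suc n} F 1≤Δ _ =
  record { nb = selfGraph ; tbl = λ v → tabS λ () } , selfGraph-maxDeg Δ 1≤Δ , λ { (() Vec.∷ _) }
bDesc-of {suc q} F 1≤Δ (nb , maxDeg , comm) = D , maxDeg , λ x → vec-ext λ v → sym (begin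
  lookup (netOf D x) v ≡⟨ lookup∘tabulate _ v ⟩
  applyT (BDesc.tbl D v) (Vec.map (lookup x) (fromList (nb v))) ≡⟨ applyT-tableOf (length (nb v)) _ _ ⟩
  lookup (F (tabulate (assign (nb v) (Vec.map (lookup x) (fromList (nb v)))))) v
    ≡⟨ comm _ x v (λ u u∈ → trans (lookup∘tabulate _ u) (assign-agrees (nb v) x u∈)) ⟩
  lookup (F x) v ∎)
  where
    open ≡-Reasoning
    D : BDesc (suc q) _
    D = record { nb = nb ; tbl = λ v → tableOf (length (nb v)) λ as → lookup (F (tabulate (assign (nb v) as))) v }

-- Polynomial versus exponential growth

evalPoly-mono : ∀ p {x y} → x ≤ y → evalPoly p x ≤ evalPoly p y
evalPoly-mono []      x≤y = z≤n
evalPoly-mono (a ∷ p) x≤y = +-monoʳ-≤ a (*-mono-≤ x≤y (evalPoly-mono p x≤y))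

_+ᵖ_ : Poly → Poly → Poly
[]      +ᵖ q       = q
(a ∷ p) +ᵖ []      = a ∷ p
(a ∷ p) +ᵖ (b ∷ q) = (a + b) ∷ (p +ᵖ q)

evalPoly-+ᵖ : ∀ p q n → evalPoly (p +ᵖ q) n ≡ evalPoly p n + evalPoly q n
evalPoly-+ᵖ []      q       n = refl
evalPoly-+ᵖ (a ∷ p) []      n = sym (+-identityʳ _)
evalPoly-+ᵖ (a ∷ p) (b ∷ q) n = trans (cong (λ r → a + b + n * r) (evalPoly-+ᵖ p q n))
  (solve 5 (λ a b n x y → a :+ b :+ n :* (x :+ y) := (a :+ n :* x) :+ (b :+ n :* y)) refl a b n (evalPoly p n) (evalPoly q n))

n<2^n : ∀ n → n < 2 ^ n
n<2^n zero    = s≤s z≤n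
n<2^n (suc n) = begin
  suc (suc n)        ≤⟨ +-mono-≤ (m^n>0 2 n) (n<2^n n) ⟩
  2 ^ n + 2 ^ n      ≡⟨ cong (2 ^ n +_) (+-identityʳ (2 ^ n)) ⟨
  2 ^ suc n          ∎
  where open ≤-Reasoning

^-distribʳ-* : ∀ a b d → (a * b) ^ d ≡ a ^ d * b ^ d
^-distribʳ-* a b zero    = refl
^-distribʳ-* a b (suc d) = trans (cong (a * b *_) (^-distribʳ-* a b d))
  (solve 4 (λ a b x y → a :* b :* (x :* y) := a :* x :* (b :* y)) refl a b (a ^ d) (b ^ d))

PolyGrowth : (ℕ → ℕ) → Set
PolyGrowth f = ∃₂ λ C d → ∀ n → f n ≤ C * suc n ^ d

evalPoly-polyGrowth : ∀ p → PolyGrowth (evalPoly p)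
evalPoly-polyGrowth []      = 0 , 0 , λ n → z≤n
evalPoly-polyGrowth (a ∷ p) with evalPoly-polyGrowth p
... | C , d , bound = a + C , suc d , λ n → begin
  a + n * evalPoly p n                        ≤⟨ +-mono-≤ (m≤m*n a (suc n ^ suc d) {{>-nonZero (m^n>0 (suc n) (suc d))}})
                                                          (*-mono-≤ (n≤1+n n) (bound n)) ⟩
  a * suc n ^ suc d + suc n * (C * suc n ^ d) ≡⟨ solve 4 (λ a C x y → a :* (x :* y) :+ x :* (C :* y) := (a :+ C) :* (x :* y))
                                                   refl a C (suc n) (suc n ^ d) ⟩
  (a + C) * suc n ^ suc d                     ∎
  where open ≤-Reasoning

polyGrowth-* : ∀ {f g} → PolyGrowth f → PolyGrowth g → PolyGrowth (λ n → f n * g n)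
polyGrowth-* (C₁ , d₁ , bound₁) (C₂ , d₂ , bound₂) = C₁ * C₂ , d₁ + d₂ , λ n → begin
  _                                     ≤⟨ *-mono-≤ (bound₁ n) (bound₂ n) ⟩
  C₁ * suc n ^ d₁ * (C₂ * suc n ^ d₂)   ≡⟨ solve 4 (λ a b x y → a :* x :* (b :* y) := a :* b :* (x :* y))
                                             refl C₁ C₂ (suc n ^ d₁) (suc n ^ d₂) ⟩
  C₁ * C₂ * (suc n ^ d₁ * suc n ^ d₂)   ≡⟨ cong (C₁ * C₂ *_) (^-distribˡ-+-* (suc n) d₁ d₂) ⟨
  C₁ * C₂ * suc n ^ (d₁ + d₂)           ∎
  where open ≤-Reasoning

polyGrowth-∘ : ∀ {f g} → PolyGrowth f → PolyGrowth g → PolyGrowth (f ∘ g)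
polyGrowth-∘ {f} {g} (C₁ , d₁ , bound₁) (C₂ , d₂ , bound₂) = C₁ * suc C₂ ^ d₁ , d₂ * d₁ , λ n → begin
  f (g n)                                   ≤⟨ bound₁ (g n) ⟩
  C₁ * suc (g n) ^ d₁                       ≤⟨ *-monoʳ-≤ C₁ (^-monoˡ-≤ d₁ (s≤s (bound₂ n))) ⟩
  C₁ * suc (C₂ * suc n ^ d₂) ^ d₁           ≤⟨ *-monoʳ-≤ C₁ (^-monoˡ-≤ d₁ (+-monoˡ-≤ (C₂ * suc n ^ d₂) (m^n>0 (suc n) d₂))) ⟩
  C₁ * (suc C₂ * suc n ^ d₂) ^ d₁           ≡⟨ cong (C₁ *_) (^-distribʳ-* (suc C₂) _ d₁) ⟩
  C₁ * (suc C₂ ^ d₁ * (suc n ^ d₂) ^ d₁)    ≡⟨ *-assoc C₁ _ _ ⟨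
  C₁ * suc C₂ ^ d₁ * (suc n ^ d₂) ^ d₁      ≡⟨ cong (C₁ * suc C₂ ^ d₁ *_) (^-*-assoc (suc n) d₂ d₁) ⟩
  C₁ * suc C₂ ^ d₁ * suc n ^ (d₂ * d₁)      ∎
  where open ≤-Reasoning

polyGrowth-suc : PolyGrowth suc
polyGrowth-suc = 1 , 1 , λ n → ≤-reflexive (solve 1 (λ n → con 1 :+ n := con 1 :* ((con 1 :+ n) :* con 1)) refl n)

-- With j = 2 i for i = 1 + a + 2 b one has a + b j ≤ i * i ≤ 2 ^ j.
linear<2^ : ∀ a b → ∃ λ j → a + b * j ≤ 2 ^ j
linear<2^ a b = i + i , (begin
  a + b * (i + i)                 ≤⟨ +-monoˡ-≤ (b * (i + i)) (m≤m+n a (k * a)) ⟩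
  (a + k * a) + b * (i + i)       ≤⟨ m≤m+n _ i ⟩
  (a + k * a) + b * (i + i) + i   ≡⟨ solve 2 (λ a b → (a :+ (a :+ b :* con 2) :* a) :+ b :* ((con 1 :+ (a :+ b :* con 2)) :+ (con 1 :+ (a :+ b :* con 2))) :+ (con 1 :+ (a :+ b :* con 2))
                                          := (con 1 :+ (a :+ b :* con 2)) :* (con 1 :+ (a :+ b :* con 2))) refl a b ⟩
  i * i                           ≤⟨ *-mono-≤ (<⇒≤ (n<2^n i)) (<⇒≤ (n<2^n i)) ⟩
  2 ^ i * 2 ^ i                   ≡⟨ ^-distribˡ-+-* 2 i i ⟨
  2 ^ (i + i)                     ∎)
  where
    open ≤-Reasoning
    k = a + b * 2
    i = suc k

-- Evaluated at n = 2 ^ j, a bound C (n + 1) ^ d is at most 2 ^ (C + (j + 1) d).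
polyGrowth-below-2^ : ∀ {f} → PolyGrowth f → ∀ N → ∃ λ n → N ≤ n × f n < 2 ^ n
polyGrowth-below-2^ {f} (C , d , bound) N with linear<2^ (C + d + N) d
... | j , small = 2 ^ j , N≤2^j , (begin-strict
  f (2 ^ j)                 ≤⟨ bound (2 ^ j) ⟩
  C * suc (2 ^ j) ^ d       ≤⟨ *-monoʳ-≤ C (^-monoˡ-≤ d (+-monoˡ-≤ (2 ^ j) (m^n>0 2 j))) ⟩
  C * (2 ^ j + 2 ^ j) ^ d   ≡⟨ cong (λ t → C * (2 ^ j + t) ^ d) (+-identityʳ (2 ^ j)) ⟨
  C * (2 ^ suc j) ^ d       ≡⟨ cong (C *_) (^-*-assoc 2 (suc j) d) ⟩
  C * Y                     <⟨ +-monoˡ-< (C * Y) (m^n>0 2 (suc j * d)) ⟩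
  suc C * Y                 ≤⟨ *-monoˡ-≤ Y (n<2^n C) ⟩
  2 ^ C * Y                 ≡⟨ ^-distribˡ-+-* 2 C (suc j * d) ⟨
  2 ^ (C + suc j * d)       ≤⟨ ^-monoʳ-≤ 2 exponent-≤ ⟩
  2 ^ (2 ^ j)               ∎)
  where
    open ≤-Reasoning
    Y = 2 ^ (suc j * d)
    exponent-≤ : C + suc j * d ≤ 2 ^ j
    exponent-≤ = ≤-trans (≤-reflexive (solve 3 (λ C d j → C :+ (con 1 :+ j) :* d := C :+ d :+ d :* j) refl C d j))
                   (≤-trans (+-monoˡ-≤ (d * j) (m≤m+n (C + d) N)) small)
    N≤2^j : N ≤ 2 ^ j
    N≤2^j = ≤-trans (≤-trans (m≤n+m N (C + d)) (m≤m+n (C + d + N) (d * j))) small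

linear/≤ : ∀ {m} A B n → 1 ≤ n → m ≤ A * suc n + B → m / suc (A + A + B) ≤ n
linear/≤ {m} A B n@(suc _) _ m≤ = ≤-trans (/-monoˡ-≤ (suc (A + A + B)) m≤n*c) (≤-reflexive (m*n/n≡m n (suc (A + A + B))))
  where
    open ≤-Reasoning
    m≤n*c : m ≤ n * suc (A + A + B)
    m≤n*c = begin
      m                             ≤⟨ m≤ ⟩
      A * suc n + B                 ≡⟨ solve 3 (λ A B n → A :* (con 1 :+ n) :+ B := A :* n :+ A :+ B) refl A B n ⟩
      A * n + A + B                 ≤⟨ +-mono-≤ (+-monoʳ-≤ (A * n) (m≤n*m A n)) (m≤n*m B n) ⟩
      A * n + n * A + n * B         ≤⟨ m≤n+m _ n ⟩
      n + (A * n + n * A + n * B)   ≡⟨ solve 3 (λ A B n → n :+ (A :* n :+ n :* A :+ n :* B) := n :* (con 1 :+ (A :+ A :+ B))) refl A B n ⟩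
      n * suc (A + A + B)           ∎

-- Universal and strongly universal families

EmbeddedIn : Family → (ℕ → ℕ) → ∀ {q n} → Net q n → Set
EmbeddedIn 𝓕 δ F = Σ ℕ λ q′ → Σ ℕ λ m → Σ (Net q′ m) λ H → Member 𝓕 q′ m H × EmbedsWith δ F H

PeriodAtLeast : Family → (ℕ → ℕ) → ℕ → Set
PeriodAtLeast 𝓕 bound N = Σ ℕ λ q → Σ ℕ λ n → Σ (Net q n) λ F →
  (N ≤ n) × Member 𝓕 q n F × Σ (Config q n) λ x → Σ ℕ λ per → IsPeriod F x per × (bound n ≤ per)

TransientAtLeast : Family → (ℕ → ℕ) → ℕ → Set
TransientAtLeast 𝓕 bound N = Σ ℕ λ q → Σ ℕ λ n → Σ (Net q n) λ F →
  (N ≤ n) × Member 𝓕 q n F × Σ (Config q n) λ x → Σ ℕ λ τ → IsTransient F x τ × (bound n ≤ τ)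

ManyOrbits : Family → (count period : ℕ → ℕ) → ℕ → Set
ManyOrbits 𝓕 count period N = Σ ℕ λ q → Σ ℕ λ n → Σ (Net q n) λ F →
  (N ≤ n) × Member 𝓕 q n F × Σ (List (Config q n)) λ xs →
    (count n ≤ length xs) × All (PeriodicLe F (period n)) xs × PairwiseDisjoint F xs

module _ {𝓕 : Family} {m T : ℕ} where

  host⇒embeddedIn : ∀ {q n} {F : Net q n} → Host 𝓕 F m T → ∀ δ → m ≤ δ n → T ≤ δ n → EmbeddedIn 𝓕 δ F
  host⇒embeddedIn h δ m≤ T≤ = alphabet , m , network , member , m≤ , T , T≤ , φ , (λ _ _ → φ-injective) , φ-commutes
    where
      open Host h
      open OrbitEmbedding embedding

  counterHost⇒period : ∀ {n N} → Host 𝓕 (counter n) m T → N ≤ m → ∀ bound → bound m ≤ 2 ^ n →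
    PeriodAtLeast 𝓕 bound N
  counterHost⇒period {n} h N≤m bound small =
    let per , isPeriod , long = period-≥ (time-positive (counter-moves n)) (λ {k} → Counter.period-≥ n {k})
    in alphabet , m , network , N≤m , member , φ zeros , per , isPeriod , ≤-trans small long
    where
      open Host h
      open OrbitEmbedding embedding
      open OrbitEmbeddingProperties embedding

  counterHost⇒transient : ∀ {n N} → Host 𝓕 (counter n) m T → N ≤ m → ∀ bound → bound m ≤ 2 ^ n →
    TransientAtLeast 𝓕 bound N
  counterHost⇒transient {n} h N≤m bound small =
    let τ , isTransient , long = transient-≥ (time-positive (counter-moves n)) (λ {k} → Counter.transient-≥ n {k})
    in alphabet , m , network , N≤m , member , φ zeros , τ , isTransient , ≤-trans small long
    where
      open Host h
      open OrbitEmbedding embedding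
      open OrbitEmbeddingProperties embedding

  flipperHost⇒orbits : ∀ {k N} → Host 𝓕 (flipper k) m T → N ≤ m → ∀ count period →
    2 * T ≤ period m → (∀ ℓ → 4 ^ suc k ≤ ℓ * (2 * T) → count m ≤ ℓ) → ManyOrbits 𝓕 count period N
  flipperHost⇒orbits {k} h N≤m count period 2T≤ enough =
    let xs , counted , periodic , disjoint =
          involution⇒disjointOrbits embedding (flipper-involutive k) (time-positive (flipper-moves k))
    in alphabet , m , network , N≤m , member , xs , enough (length xs) counted ,
       All.map (λ (j , 1≤j , j≤2T , back) → j , 1≤j , ≤-trans j≤2T 2T≤ , back) periodic , disjoint
    where
      open Host h
      open OrbitEmbeddingProperties embedding

record PolynomialSimulation (𝓕 : Family) (R : Representation) : Set where
  field
    time space         : ℕ → ℕ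
    timePoly spacePoly : Poly
    time-≤             : ∀ n → time n ≤ evalPoly timePoly n
    space-≤            : ∀ n → space n ≤ evalPoly spacePoly n
    simulation         : Simulates 𝓕 R time space

  host : ∀ {w q n} {F : Net q n} → R w q n F → Host 𝓕 F (space n) (time n)
  host = simulates⇒host {𝓕} {R} {time} {space} simulation

polynomialSimulation : ∀ {𝓕} → Universal 𝓕 → ∀ q P → PolynomialSimulation 𝓕 (RepU q P)
polynomialSimulation universal q P with universal q P
... | T , S , (pT , T≤) , (pS , S≤) , sim = record
  { time = T ; space = S ; timePoly = pT ; spacePoly = pS ; time-≤ = T≤ ; space-≤ = S≤ ; simulation = sim }

universal⇒polyEmbedding : ∀ 𝓕 → Universal 𝓕 → PolyEmbedding 𝓕
universal⇒polyEmbedding 𝓕 universal q ρ = timePoly +ᵖ spacePoly , λ n F (C , correct , small) →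
  host⇒embeddedIn (host (refl , C , refl , small , correct)) (evalPoly (timePoly +ᵖ spacePoly))
    (≤-trans (space-≤ n) (≤-trans (m≤n+m _ _) (≤-reflexive (sym (evalPoly-+ᵖ timePoly spacePoly n)))))
    (≤-trans (time-≤ n) (≤-trans (m≤m+n _ _) (≤-reflexive (sym (evalPoly-+ᵖ timePoly spacePoly n)))))
  where open PolynomialSimulation (polynomialSimulation {𝓕} universal q ρ)

localSizePoly : Poly
localSizePoly = 0 ∷ 4 * outputBitSize 3 ∷ []

localCircuit-≤ : ∀ {M} (g : Rule 4 M) → size (LocalCircuit.circuit {3} g) ≤ evalPoly localSizePoly M
localCircuit-≤ {M} g = ≤-trans (LocalCircuit.circuit-size g)
  (≤-reflexive (cong (M *_) (sym (trans (cong (4 * outputBitSize 3 +_) (*-zeroʳ M)) (+-identityʳ (4 * outputBitSize 3))))))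

module UniversalConsequences (𝓕 : Family) (universal : Universal 𝓕) where
  open PolynomialSimulation (polynomialSimulation {𝓕} universal 4 localSizePoly)

  localHost : ∀ {M} (g : Rule 4 M) → Host 𝓕 (local g) (space M) (time M)
  localHost g = host (refl , LocalCircuit.circuit {3} g , refl , localCircuit-≤ g , LocalCircuit.circuit-correct g)

  sizeGrowth : ∀ p → PolyGrowth (evalPoly p ∘ evalPoly spacePoly ∘ suc)
  sizeGrowth p = polyGrowth-∘ (evalPoly-polyGrowth p) (polyGrowth-∘ (evalPoly-polyGrowth spacePoly) polyGrowth-suc)

  counterBeyond : ∀ p N → ∃ λ n → N ≤ space (suc n) × evalPoly p (space (suc n)) < 2 ^ n
  counterBeyond p N =
    let n , N≤n , small = polyGrowth-below-2^ (sizeGrowth p) N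
    in n , ≤-trans (m≤n⇒m≤1+n N≤n) (Host.n≤m (localHost (counterRule n))) ,
       ≤-trans (s≤s (evalPoly-mono p (space-≤ (suc n)))) small

  superPolyPeriods : SuperPolyPeriods 𝓕
  superPolyPeriods p N =
    let n , N≤m , small = counterBeyond p N
    in counterHost⇒period (localHost (counterRule n)) N≤m (suc ∘ evalPoly p) small

  superPolyTransients : SuperPolyTransients 𝓕
  superPolyTransients p N =
    let n , N≤m , small = counterBeyond p N
    in counterHost⇒transient (localHost (counterRule n)) N≤m (suc ∘ evalPoly p) small

  periodPoly : Poly
  periodPoly = timePoly +ᵖ timePoly

  twice-time-≤ : ∀ {M m} → M ≤ m → 2 * time M ≤ evalPoly periodPoly m
  twice-time-≤ {M} {m} M≤m = begin
    2 * time M                                  ≤⟨ *-monoʳ-≤ 2 (≤-trans (time-≤ M) (evalPoly-mono timePoly M≤m)) ⟩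
    2 * evalPoly timePoly m                     ≡⟨ cong (evalPoly timePoly m +_) (+-identityʳ _) ⟩
    evalPoly timePoly m + evalPoly timePoly m   ≡⟨ evalPoly-+ᵖ timePoly timePoly m ⟨
    evalPoly periodPoly m                       ∎
    where open ≤-Reasoning

  orbitGrowth : ∀ p → PolyGrowth (λ k → evalPoly p (evalPoly spacePoly (suc k)) * evalPoly periodPoly (suc k))
  orbitGrowth p = polyGrowth-* (sizeGrowth p) (polyGrowth-∘ (evalPoly-polyGrowth periodPoly) polyGrowth-suc)

  -- Fewer than p (space (k + 1)) orbits of size 2 * time (k + 1) cannot cover the 4 ^ (k + 1)
  -- configurations of the flipper.
  superPolyManyOrbits : SuperPolyManyOrbits 𝓕
  superPolyManyOrbits = periodPoly , λ p N →
    let k , N≤k , small = polyGrowth-below-2^ (orbitGrowth p) N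
        h = localHost (flipRule {suc k})
    in flipperHost⇒orbits h (≤-trans (m≤n⇒m≤1+n N≤k) (Host.n≤m h)) (suc ∘ evalPoly p) (evalPoly periodPoly)
         (twice-time-≤ (Host.n≤m h)) (enough p k small)
    where
      enough : ∀ p k → evalPoly p (evalPoly spacePoly (suc k)) * evalPoly periodPoly (suc k) < 2 ^ k →
        ∀ ℓ → 4 ^ suc k ≤ ℓ * (2 * time (suc k)) → evalPoly p (space (suc k)) < ℓ
      enough p k small ℓ covered = ≰⇒> λ ℓ≤ → <⇒≱ (begin-strict
        ℓ * (2 * time (suc k))                                            ≤⟨ *-mono-≤ (≤-trans ℓ≤ (evalPoly-mono p (space-≤ (suc k))))
                                                                                      (twice-time-≤ ≤-refl) ⟩
        evalPoly p (evalPoly spacePoly (suc k)) * evalPoly periodPoly (suc k) <⟨ small ⟩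
        2 ^ k                                                             ≤⟨ ^-monoʳ-≤ 2 (n≤1+n k) ⟩
        2 ^ suc k                                                         ≤⟨ ^-monoˡ-≤ (suc k) (s≤s (s≤s z≤n)) ⟩
        4 ^ suc k                                                         ∎) covered
        where open ≤-Reasoning

record LinearSimulation (𝓕 : Family) (R : Representation) : Set where
  field
    time space            : ℕ → ℕ
    timeBound slope shift : ℕ
    time-≤                : ∀ n → time n ≤ timeBound
    space-≤               : ∀ n → space n ≤ slope * n + shift
    simulation            : Simulates 𝓕 R time space

  host : ∀ {w q n} {F : Net q n} → R w q n F → Host 𝓕 F (space n) (time n)
  host = simulates⇒host {𝓕} {R} {time} {space} simulation

linearSimulation : ∀ {𝓕} → StronglyUniversal 𝓕 → ∀ q Δ → 1 ≤ Δ → LinearSimulation 𝓕 (RepB q Δ)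
linearSimulation strong q Δ 1≤Δ with strong q Δ 1≤Δ
... | T , S , (c , T≤) , (a , b , S≤) , sim = record
  { time = T ; space = S ; timeBound = c ; slope = a ; shift = b ; time-≤ = T≤ ; space-≤ = S≤ ; simulation = sim }

stronglyUniversal⇒linearEmbedding : ∀ 𝓕 → StronglyUniversal 𝓕 → LinearEmbedding 𝓕
stronglyUniversal⇒linearEmbedding 𝓕 strong q Δ 1≤Δ = slope , shift + timeBound , λ n F inB →
  let D , maxDeg , F≡netOf = bDesc-of F 1≤Δ inB
  in host⇒embeddedIn (host (refl , D , maxDeg , refl , F≡netOf)) (λ k → slope * k + (shift + timeBound))
       (≤-trans (space-≤ n) (+-monoʳ-≤ (slope * n) (m≤m+n shift timeBound)))
       (≤-trans (time-≤ n) (≤-trans (m≤n+m timeBound shift) (m≤n+m _ (slope * n))))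
  where open LinearSimulation (linearSimulation {𝓕} strong q Δ 1≤Δ)

module StrongUniversalityConsequences (𝓕 : Family) (strong : StronglyUniversal 𝓕) where
  open LinearSimulation (linearSimulation {𝓕} strong 4 2 (s≤s z≤n))

  localHost : ∀ {M} (g : Rule 4 M) → Host 𝓕 (local g) (space M) (time M)
  localHost g =
    let D , maxDeg , F≡netOf = bDesc-of (local g) (s≤s z≤n) (local-inB g)
    in host (refl , D , maxDeg , refl , F≡netOf)

  rate : ℕ
  rate = slope + slope + shift

  exponent-≤ : ∀ n → 1 ≤ n → 2 ^ (space (suc n) / suc rate) ≤ 2 ^ n
  exponent-≤ n 1≤n = ^-monoʳ-≤ 2 (linear/≤ slope shift n 1≤n (space-≤ (suc n)))

  expPeriods : ExpPeriods 𝓕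
  expPeriods = rate , λ N →
    let h = localHost (counterRule (suc N))
    in counterHost⇒period h (≤-trans (n≤1+n N) (≤-trans (n≤1+n (suc N)) (Host.n≤m h)))
         (λ m → 2 ^ (m / suc rate)) (exponent-≤ (suc N) (s≤s z≤n))

  expTransients : ExpTransients 𝓕
  expTransients = rate , λ N →
    let h = localHost (counterRule (suc N))
    in counterHost⇒transient h (≤-trans (n≤1+n N) (≤-trans (n≤1+n (suc N)) (Host.n≤m h)))
         (λ m → 2 ^ (m / suc rate)) (exponent-≤ (suc N) (s≤s z≤n))

  -- On M ≥ 2 * timeBound + 1 nodes an orbit of size 2 * time M ≤ 2 ^ M covers at most 2 ^ M
  -- of the 4 ^ M configurations of the flipper.
  expManyOrbits : ExpManyOrbits 𝓕
  expManyOrbits = rate , 0 , 2 * timeBound , λ N →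
    let k = suc (N + 2 * timeBound)
        h = localHost (flipRule {suc k})
    in flipperHost⇒orbits h (≤-trans (≤-trans (m≤m+n N _) (n≤1+n _)) (≤-trans (n≤1+n k) (Host.n≤m h)))
         (λ m → 2 ^ (m / suc rate)) (λ m → 0 * m + 2 * timeBound) (*-monoʳ-≤ 2 (time-≤ (suc k))) (enough N)
    where
      enough : ∀ N → let k = suc (N + 2 * timeBound) in
        ∀ ℓ → 4 ^ suc k ≤ ℓ * (2 * time (suc k)) → 2 ^ (space (suc k) / suc rate) ≤ ℓ
      enough N ℓ covered = ≤-trans (exponent-≤ k (s≤s z≤n)) (≤-trans (^-monoʳ-≤ 2 (n≤1+n k))
        (*-cancelʳ-≤ (2 ^ M) ℓ (2 ^ M) {{m^n≢0 2 M}} (begin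
          2 ^ M * 2 ^ M             ≡⟨ ^-distribˡ-+-* 2 M M ⟨
          2 ^ (M + M)               ≡⟨ cong (λ t → 2 ^ (M + t)) (+-identityʳ M) ⟨
          2 ^ (2 * M)               ≡⟨ ^-*-assoc 2 2 M ⟨
          4 ^ M                     ≤⟨ covered ⟩
          ℓ * (2 * time M)          ≤⟨ *-monoʳ-≤ ℓ time≤2^M ⟩
          ℓ * 2 ^ M                 ∎)))
        where
          open ≤-Reasoning
          k = suc (N + 2 * timeBound)
          M = suc k
          time≤2^M : 2 * time M ≤ 2 ^ M
          time≤2^M = ≤-trans (*-monoʳ-≤ 2 (time-≤ M))
            (≤-trans (m≤n+m _ N) (≤-trans (n≤1+n _) (≤-trans (n≤1+n k) (<⇒≤ (n<2^n M)))))

mainTheorem10 : (𝓕 : Family) →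
    (Universal 𝓕 →
      PolyEmbedding 𝓕 × SuperPolyPeriods 𝓕 × SuperPolyTransients 𝓕 × SuperPolyManyOrbits 𝓕) ×
    (StronglyUniversal 𝓕 →
      LinearEmbedding 𝓕 × ExpPeriods 𝓕 × ExpTransients 𝓕 × ExpManyOrbits 𝓕)
mainTheorem10 𝓕 =
  (λ universal → let open UniversalConsequences 𝓕 universal in
     universal⇒polyEmbedding 𝓕 universal , superPolyPeriods , superPolyTransients , superPolyManyOrbits) ,
  (λ strong → let open StrongUniversalityConsequences 𝓕 strong in
     stronglyUniversal⇒linearEmbedding 𝓕 strong , expPeriods , expTransients , expManyOrbits)
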